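{- For every sufficiently large integer $r$, there exist two families $\mathcal I_1,\mathcal I_2$ of subsets of $\{1,\ldots,8r\}$, each of size $2^{2r}$, such that both are paired $q$-uniform for $q=\lceil 2r/5\rceil$, they are $\frac{1}{30}$-pairwise far from each other, and every member of $\mathcal I_1\cup\mathcal I_2$ has exactly $4r$ elements.
   Context: Here $k=8r$. For a set of integers $I$ and an integer $m$, $m-I=\{m-i:i\in I\}$ and $\neg_k I=\{1,\ldots,k\}\setminus I$. A set $I\subseteq\{1,\ldots,k\}$ ($k$ even) is $k$-paired if $(k+1)-I=\neg_k I$. A family $\mathcal I\subseteq 2^{\{1,\ldots,k\}}$ is paired $q$-uniform if every $I\in\mathcal I$ is $k$-paired, and for every $J\subseteq\{1,\ldots,k\}$ of size $q$ that is disjoint from $(k+1)-J$, the intersection $J\cap I$ for a uniformly drawn $I\in\mathcal I$ is uniformly distributed over $2^J$. Two families $\mathcal I_1,\mathcal I_2\subseteq 2^{\{1,\ldots,k\}}$ are $\varepsilon$-pairwise far if $|I_1\triangle I_2|>\varepsilon k$ for every $I_1\in\mathcal I_1$ and $I_2\in\mathcal I_2$. -}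

module Defs where

open import Data.Nat using (ℕ; _+_; _*_; _^_; _<_; _/_)
open import Data.Bool using (Bool)
import Data.Bool as B
open import Data.Fin using (Fin; opposite)
open import Data.Fin.Subset using (Subset; ∁; _∩_; _∪_; _─_; ∣_∣; ⊥)
open import Data.Vec using (tabulate; lookup)
open import Data.Vec.Properties using (≡-dec)
open import Data.List using (List; length; filter)
open import Data.List.Membership.Propositional using (_∈_)
open import Relation.Binary.PropositionalEquality using (_≡_)
open import Relation.Binary.Definitions using (DecidableEquality)
open import Data.Product using (_×_)

-- Convention: the ground set {1,…,k} is represented by Fin k,
-- with element i ∈ Fin k standing for the integer (toℕ i + 1).
-- Under this convention the map j ↦ (k+1) - j is Data.Fin.opposite.

_≟ˢ_ : ∀ {k} → DecidableEquality (Subset k)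
_≟ˢ_ = ≡-dec B._≟_

reflect : ∀ {k} → Subset k → Subset k
reflect I = tabulate (λ i → lookup I (opposite i))

_△_ : ∀ {k} → Subset k → Subset k → Subset k
I △ J = (I ─ J) ∪ (J ─ I)

Paired : ∀ {k} → Subset k → Set
Paired I = reflect I ≡ ∁ I

countWith : ∀ {k} → List (Subset k) → Subset k → Subset k → ℕ
countWith 𝓘 J A = length (filter (λ I → (J ∩ I) ≟ˢ A) 𝓘)

-- Paired q-uniform family (the family is a list of distinct subsets; a uniformly
-- drawn member gives J ∩ I uniform over 2^J iff every A ⊆ J is hit by exactly
-- |𝓘| / 2^|J| members, i.e. count * 2^q = |𝓘|).
PairedUniform : ∀ {k} → ℕ → List (Subset k) → Set
PairedUniform {k} q 𝓘 =
  (∀ {I} → I ∈ 𝓘 → Paired I) ×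
  (∀ (J : Subset k) → ∣ J ∣ ≡ q → J ∩ reflect J ≡ ⊥ →
     ∀ (A : Subset k) → A Data.Fin.Subset.⊆ J → countWith 𝓘 J A * 2 ^ q ≡ length 𝓘)

-- ε-pairwise far with ε = a / b (b > 0): |I₁ △ I₂| > (a/b) k, i.e. a * k < b * |I₁ △ I₂|
PairwiseFar : ∀ {k} → ℕ → ℕ → List (Subset k) → List (Subset k) → Set
PairwiseFar {k} a b 𝓘₁ 𝓘₂ = ∀ {I₁ I₂} → I₁ ∈ 𝓘₁ → I₂ ∈ 𝓘₂ → a * k < b * ∣ I₁ △ I₂ ∣

ceil5 : ℕ → ℕ
ceil5 n = (n + 4) / 5

{-# OPTIONS --safe #-}
module Submission where

-- Read subsets of Fin k as bit vectors over 𝔽₂. A subset of Fin (n + n) is paired exactly when it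
-- is z ++ reverse (∁ z) for its first half z, and such a set meets a pair-free J of size q in a
-- pattern fixed by q bits of z (the positions of J folded onto the first half). Take the code
-- C = {xG : x ∈ 𝔽₂ᵐ} of length n = 2m whose generator columns are q-wise independent, q = ⌈m/5⌉,
-- and include the m unit vectors, so that x ↦ xG is injective. The other columns are chosen
-- greedily (Gilbert–Varshamov), which works because a Hamming ball of radius q - 1 in 𝔽₂²ᵐ has
-- fewer than 2ᵐ points. By Gaussian elimination any q coordinates of a uniformly random codeword
-- are uniform, also for a translate C + v. The two families are the paired sets of C and of a
-- translate C + v with v at distance ≥ q from C, which exists by the same counting. Two paired
-- sets are twice as far apart as their halves, so members of the two families differ in at least
-- 2q > 8r/30 points, while every member has n = 4r elements (m = 2r).

module LinearAlgebra where

  open import Data.Bool using (Bool; true; false; _∧_; _xor_; if_then_else_)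
  open import Data.Bool.Properties using (xor-assoc; xor-identityʳ; xor-same; ∧-comm)
  open import Data.Bool.Solver using (module xor-∧-Solver)
  open import Data.Fin using (Fin; zero; suc)
  open import Data.Fin.Subset using (Subset; ⊥; ⁅_⁆; _∈_; _⊆_)
  open import Data.Fin.Subset.Properties using (∉⊥)
  open import Data.Nat using (ℕ; zero; suc)
  open import Data.Sum using (_⊎_; inj₁; inj₂; [_,_]′)
  import Data.Sum as Sum
  open import Data.Vec using (Vec; []; _∷_; here; there; _++_; zipWith; map; lookup; head; tail; tabulate)
  open import Data.Vec.Properties
    using (zipWith-assoc; zipWith-identityˡ; zipWith-identityʳ; map-++; lookup-replicate;
           tabulate∘lookup; tabulate-∘; tabulate-cong)
  open import Relation.Nullary using (contradiction)
  open import Relation.Binary.PropositionalEquality using (_≡_; refl; sym; trans; cong; cong₂)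
  open Relation.Binary.PropositionalEquality.≡-Reasoning

  private
    variable
      k m n : ℕ

  infixr 7 _·_ _⊛_
  infixl 6 _⊕_
  infix  8 _∙_

  _⊕_ : Subset n → Subset n → Subset n
  _⊕_ = zipWith _xor_

  _·_ : Bool → Subset n → Subset n
  c · p = if c then p else ⊥

  _∙_ : Subset n → Subset n → Bool
  []      ∙ []      = false
  (a ∷ p) ∙ (b ∷ q) = (a ∧ b) xor p ∙ q

  _⊛_ : Subset k → Vec (Subset m) k → Subset m
  []      ⊛ []      = ⊥
  (a ∷ u) ⊛ (g ∷ G) = a · g ⊕ u ⊛ G

  encode : Vec (Subset m) n → Subset m → Subset n
  encode G x = map (x ∙_) G

  ⊕-assoc : (p q r : Subset n) → (p ⊕ q) ⊕ r ≡ p ⊕ (q ⊕ r)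
  ⊕-assoc = zipWith-assoc xor-assoc

  ⊕-identityˡ : (p : Subset n) → ⊥ ⊕ p ≡ p
  ⊕-identityˡ = zipWith-identityˡ λ _ → refl

  ⊕-identityʳ : (p : Subset n) → p ⊕ ⊥ ≡ p
  ⊕-identityʳ = zipWith-identityʳ xor-identityʳ

  ⊕-self : (p : Subset n) → p ⊕ p ≡ ⊥
  ⊕-self []      = refl
  ⊕-self (a ∷ p) = cong₂ _∷_ (xor-same a) (⊕-self p)

  ⊕-cancelˡ : (p q : Subset n) → p ⊕ (p ⊕ q) ≡ q
  ⊕-cancelˡ p q = begin
    p ⊕ (p ⊕ q) ≡⟨ ⊕-assoc p p q ⟨
    (p ⊕ p) ⊕ q ≡⟨ cong (_⊕ q) (⊕-self p) ⟩
    ⊥ ⊕ q       ≡⟨ ⊕-identityˡ q ⟩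
    q           ∎

  ⊕-cancelʳ : (p q : Subset n) → (p ⊕ q) ⊕ q ≡ p
  ⊕-cancelʳ p q = begin
    (p ⊕ q) ⊕ q ≡⟨ ⊕-assoc p q q ⟩
    p ⊕ (q ⊕ q) ≡⟨ cong (p ⊕_) (⊕-self q) ⟩
    p ⊕ ⊥       ≡⟨ ⊕-identityʳ p ⟩
    p           ∎

  ⊕-injectiveʳ : (r : Subset n) {p q : Subset n} → p ⊕ r ≡ q ⊕ r → p ≡ q
  ⊕-injectiveʳ r {p} {q} eq = begin
    p           ≡⟨ ⊕-cancelʳ p r ⟨
    (p ⊕ r) ⊕ r ≡⟨ cong (_⊕ r) eq ⟩
    (q ⊕ r) ⊕ r ≡⟨ ⊕-cancelʳ q r ⟩
    q           ∎

  ⊕≡⊥⇒≡ : (p q : Subset n) → p ⊕ q ≡ ⊥ → p ≡ q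
  ⊕≡⊥⇒≡ p q eq = ⊕-injectiveʳ q (trans eq (sym (⊕-self q)))

  ⊕-interchange : (p q r s : Subset n) → (p ⊕ q) ⊕ (r ⊕ s) ≡ (p ⊕ r) ⊕ (q ⊕ s)
  ⊕-interchange []      []      []      []      = refl
  ⊕-interchange (a ∷ p) (b ∷ q) (c ∷ r) (d ∷ s) =
    cong₂ _∷_ (solve 4 (λ a b c d → (a :+ b) :+ (c :+ d) := (a :+ c) :+ (b :+ d)) refl a b c d)
              (⊕-interchange p q r s)
    where open xor-∧-Solver

  lookup-⊕ : (p q : Subset n) (i : Fin n) → lookup (p ⊕ q) i ≡ lookup p i xor lookup q i
  lookup-⊕ (a ∷ p) (b ∷ q) zero    = refl
  lookup-⊕ (a ∷ p) (b ∷ q) (suc i) = lookup-⊕ p q i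

  x∈p⊕q⁻ : (p q : Subset n) {i : Fin n} → i ∈ p ⊕ q → i ∈ p ⊎ i ∈ q
  x∈p⊕q⁻ (true  ∷ p) (false ∷ q) here          = inj₁ here
  x∈p⊕q⁻ (false ∷ p) (true  ∷ q) here          = inj₂ here
  x∈p⊕q⁻ (a     ∷ p) (b     ∷ q) (there i∈p⊕q) = Sum.map there there (x∈p⊕q⁻ p q i∈p⊕q)

  ⊕-⊆ : {p q r : Subset n} → p ⊆ r → q ⊆ r → p ⊕ q ⊆ r
  ⊕-⊆ {p = p} {q} p⊆r q⊆r i∈p⊕q = [ p⊆r , q⊆r ]′ (x∈p⊕q⁻ p q i∈p⊕q)

  ·-distribˡ-⊕ : ∀ c (p q : Subset n) → c · (p ⊕ q) ≡ c · p ⊕ c · q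
  ·-distribˡ-⊕ true  p q = refl
  ·-distribˡ-⊕ false p q = sym (⊕-identityˡ ⊥)

  ·-distribʳ-xor : ∀ c d (p : Subset n) → (c xor d) · p ≡ c · p ⊕ d · p
  ·-distribʳ-xor true  true  p = sym (⊕-self p)
  ·-distribʳ-xor true  false p = sym (⊕-identityʳ p)
  ·-distribʳ-xor false d     p = sym (⊕-identityˡ (d · p))

  ·-assoc : ∀ c d (p : Subset n) → (c ∧ d) · p ≡ c · d · p
  ·-assoc true  d p = refl
  ·-assoc false d p = refl

  lookup-· : ∀ c (p : Subset n) i → lookup (c · p) i ≡ c ∧ lookup p i
  lookup-· true  p i = refl
  lookup-· false p i = lookup-replicate i false

  ·-⊆ : ∀ c {p : Subset n} → c · p ⊆ p
  ·-⊆ true  i∈p = i∈p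
  ·-⊆ false i∈⊥ = contradiction i∈⊥ ∉⊥

  ∙-comm : (p q : Subset n) → p ∙ q ≡ q ∙ p
  ∙-comm []      []      = refl
  ∙-comm (a ∷ p) (b ∷ q) = cong₂ _xor_ (∧-comm a b) (∙-comm p q)

  ⊥-∙ : (p : Subset n) → ⊥ ∙ p ≡ false
  ⊥-∙ []      = refl
  ⊥-∙ (b ∷ p) = ⊥-∙ p

  ∙-distribʳ-⊕ : (p q r : Subset n) → (p ⊕ q) ∙ r ≡ p ∙ r xor q ∙ r
  ∙-distribʳ-⊕ []      []      []      = refl
  ∙-distribʳ-⊕ (a ∷ p) (b ∷ q) (c ∷ r) = begin
    ((a xor b) ∧ c) xor (p ⊕ q) ∙ r              ≡⟨ cong (((a xor b) ∧ c) xor_) (∙-distribʳ-⊕ p q r) ⟩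
    ((a xor b) ∧ c) xor (p ∙ r xor q ∙ r)        ≡⟨ distrib a b c (p ∙ r) (q ∙ r) ⟩
    ((a ∧ c) xor p ∙ r) xor ((b ∧ c) xor q ∙ r)  ∎
    where
    open xor-∧-Solver
    distrib : ∀ a b c x y → ((a xor b) ∧ c) xor (x xor y) ≡ ((a ∧ c) xor x) xor ((b ∧ c) xor y)
    distrib = solve 5 (λ a b c x y → ((a :+ b) :* c) :+ (x :+ y) := ((a :* c) :+ x) :+ ((b :* c) :+ y)) refl

  ∙-distribˡ-⊕ : (p q r : Subset n) → p ∙ (q ⊕ r) ≡ p ∙ q xor p ∙ r
  ∙-distribˡ-⊕ p q r = begin
    p ∙ (q ⊕ r)       ≡⟨ ∙-comm p (q ⊕ r) ⟩
    (q ⊕ r) ∙ p       ≡⟨ ∙-distribʳ-⊕ q r p ⟩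
    q ∙ p xor r ∙ p   ≡⟨ cong₂ _xor_ (∙-comm q p) (∙-comm r p) ⟩
    p ∙ q xor p ∙ r   ∎

  ·-∙ : ∀ c (p q : Subset n) → (c · p) ∙ q ≡ c ∧ p ∙ q
  ·-∙ true  p q = refl
  ·-∙ false p q = ⊥-∙ q

  ∙-· : ∀ c (p q : Subset n) → p ∙ (c · q) ≡ c ∧ p ∙ q
  ∙-· c p q = trans (∙-comm p (c · q)) (trans (·-∙ c q p) (cong (c ∧_) (∙-comm q p)))

  ⁅⁆-∙ : (i : Fin n) (p : Subset n) → ⁅ i ⁆ ∙ p ≡ lookup p i
  ⁅⁆-∙ zero    (b ∷ p) = trans (cong (b xor_) (⊥-∙ p)) (xor-identityʳ b)
  ⁅⁆-∙ (suc i) (b ∷ p) = ⁅⁆-∙ i p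

  ∙-∷ : ∀ β (x : Subset m) (c : Subset (suc m)) → (β ∷ x) ∙ c ≡ (β ∧ head c) xor x ∙ tail c
  ∙-∷ β x (b ∷ c) = refl

  ∙-vanishes : (p q : Subset n) → (∀ {i} → i ∈ p → lookup q i ≡ false) → p ∙ q ≡ false
  ∙-vanishes []          []      q≡0 = refl
  ∙-vanishes (true  ∷ p) (b ∷ q) q≡0 rewrite q≡0 here = ∙-vanishes p q (λ i∈p → q≡0 (there i∈p))
  ∙-vanishes (false ∷ p) (b ∷ q) q≡0 = ∙-vanishes p q (λ i∈p → q≡0 (there i∈p))

  ⊥-⊛ : (G : Vec (Subset m) k) → ⊥ ⊛ G ≡ ⊥
  ⊥-⊛ []      = refl
  ⊥-⊛ (g ∷ G) = trans (⊕-identityˡ (⊥ ⊛ G)) (⊥-⊛ G)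

  ⊛-distribʳ-⊕ : (u v : Subset k) (G : Vec (Subset m) k) → (u ⊕ v) ⊛ G ≡ u ⊛ G ⊕ v ⊛ G
  ⊛-distribʳ-⊕ []      []      []      = sym (⊕-identityˡ ⊥)
  ⊛-distribʳ-⊕ (a ∷ u) (b ∷ v) (g ∷ G) = begin
    (a xor b) · g ⊕ (u ⊕ v) ⊛ G          ≡⟨ cong₂ _⊕_ (·-distribʳ-xor a b g) (⊛-distribʳ-⊕ u v G) ⟩
    (a · g ⊕ b · g) ⊕ (u ⊛ G ⊕ v ⊛ G)    ≡⟨ ⊕-interchange (a · g) (b · g) (u ⊛ G) (v ⊛ G) ⟩
    (a · g ⊕ u ⊛ G) ⊕ (b · g ⊕ v ⊛ G)    ∎

  ·-⊛ : ∀ c (u : Subset k) (G : Vec (Subset m) k) → (c · u) ⊛ G ≡ c · (u ⊛ G)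
  ·-⊛ true  u G = refl
  ·-⊛ false u G = ⊥-⊛ G

  ⁅⁆-⊛ : (j : Fin k) (G : Vec (Subset m) k) → ⁅ j ⁆ ⊛ G ≡ lookup G j
  ⁅⁆-⊛ zero    (g ∷ G) = trans (cong (g ⊕_) (⊥-⊛ G)) (⊕-identityʳ g)
  ⁅⁆-⊛ (suc j) (g ∷ G) = trans (⊕-identityˡ (⁅ j ⁆ ⊛ G)) (⁅⁆-⊛ j G)

  ⊛-units : (u : Subset m) → u ⊛ tabulate ⁅_⁆ ≡ u
  ⊛-units []      = refl
  ⊛-units (a ∷ u) = begin
    a · ⁅ zero ⁆ ⊕ u ⊛ tabulate (λ i → false ∷ ⁅ i ⁆)  ≡⟨ cong (a · ⁅ zero ⁆ ⊕_) (⊛-false∷ u ⁅_⁆) ⟩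
    a · ⁅ zero ⁆ ⊕ (false ∷ u ⊛ tabulate ⁅_⁆)          ≡⟨ cong (λ w → a · ⁅ zero ⁆ ⊕ (false ∷ w)) (⊛-units u) ⟩
    a · ⁅ zero ⁆ ⊕ (false ∷ u)                          ≡⟨ head-bit a ⟩
    a ∷ u                                               ∎
    where
    head-bit : ∀ a → a · ⁅ zero ⁆ ⊕ (false ∷ u) ≡ a ∷ u
    head-bit true  = cong (true ∷_) (⊕-identityˡ u)
    head-bit false = cong (false ∷_) (⊕-identityˡ u)
    ⊛-false∷ : ∀ {k m} (v : Subset k) (F : Fin k → Subset m) →
               v ⊛ tabulate (λ i → false ∷ F i) ≡ false ∷ v ⊛ tabulate F
    ⊛-false∷ []      F = refl
    ⊛-false∷ (b ∷ v) F rewrite ⊛-false∷ v (λ i → F (suc i)) with b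
    ... | true  = refl
    ... | false = refl

  ⊛-head-tail : (u : Subset k) (G : Vec (Subset (suc m)) k) → u ⊛ G ≡ u ∙ map head G ∷ u ⊛ map tail G
  ⊛-head-tail []      []            = refl
  ⊛-head-tail (a ∷ u) ((b ∷ g) ∷ G) rewrite ⊛-head-tail u G with a
  ... | true  = refl
  ... | false = refl

  ⊛-eliminate : (u : Subset k) (g : Subset m) (G : Vec (Subset (suc m)) k) →
                u ⊛ map (λ c → tail c ⊕ head c · g) G ≡ u ⊛ map tail G ⊕ (u ∙ map head G) · g
  ⊛-eliminate []      g []            = sym (⊕-identityˡ ⊥)
  ⊛-eliminate {k = suc k} {m = m} (a ∷ u) g ((b ∷ c) ∷ G) = begin
    a · (c ⊕ b · g) ⊕ u ⊛ map (λ c → tail c ⊕ head c · g) G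
      ≡⟨ cong₂ _⊕_ (trans (·-distribˡ-⊕ a c (b · g)) (cong (a · c ⊕_) (sym (·-assoc a b g))))
                   (⊛-eliminate u g G) ⟩
    (a · c ⊕ (a ∧ b) · g) ⊕ (u ⊛ T ⊕ (u ∙ h) · g)
      ≡⟨ ⊕-interchange (a · c) ((a ∧ b) · g) (u ⊛ T) ((u ∙ h) · g) ⟩
    (a · c ⊕ u ⊛ T) ⊕ ((a ∧ b) · g ⊕ (u ∙ h) · g)
      ≡⟨ cong ((a · c ⊕ u ⊛ T) ⊕_) (·-distribʳ-xor (a ∧ b) (u ∙ h) g) ⟨
    (a · c ⊕ u ⊛ T) ⊕ ((a ∧ b) xor u ∙ h) · g
      ∎
    where
    T : Vec (Subset m) k
    T = map tail G
    h : Subset k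
    h = map head G

  encode-⊕ : (G : Vec (Subset m) n) (x y : Subset m) → encode G (x ⊕ y) ≡ encode G x ⊕ encode G y
  encode-⊕ []      x y = refl
  encode-⊕ (g ∷ G) x y = cong₂ _∷_ (∙-distribʳ-⊕ x y g) (encode-⊕ G x y)

  encode-units : (C : Vec (Subset m) k) (x : Subset m) → encode (C ++ tabulate ⁅_⁆) x ≡ encode C x ++ x
  encode-units C x = begin
    map (x ∙_) (C ++ tabulate ⁅_⁆)             ≡⟨ map-++ (x ∙_) C (tabulate ⁅_⁆) ⟩
    encode C x ++ map (x ∙_) (tabulate ⁅_⁆)    ≡⟨ cong (encode C x ++_) (tabulate-∘ (x ∙_) ⁅_⁆) ⟨
    encode C x ++ tabulate (λ i → x ∙ ⁅ i ⁆)   ≡⟨ cong (encode C x ++_) (tabulate-cong λ i →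
                                                    trans (∙-comm x ⁅ i ⁆) (⁅⁆-∙ i x)) ⟩
    encode C x ++ tabulate (lookup x)          ≡⟨ cong (encode C x ++_) (tabulate∘lookup x) ⟩
    encode C x ++ x                            ∎

module SubsetProperties where

  open import Defs using (reflect; _△_)
  open LinearAlgebra using (_⊕_)
  open import Data.Bool using (Bool; true; false; not)
  open import Data.Bool.Properties using (not-involutive; xor-annihilates-not)
  open import Data.Fin using (Fin; zero; suc; opposite; fromℕ; inject₁)
  open import Data.Fin.Properties using (opposite-involutive)
  open import Data.Fin.Subset using (Subset; ⊥; ∁; _∪_; _∩_; _─_; _∈_; _∉_; _⊆_; _-_; ∣_∣)
  open import Data.Fin.Subset.Properties using (p─⊥≡p; drop-∷-⊆)
  open import Data.Nat using (ℕ; zero; suc; _+_)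
  open import Data.Nat.Properties using (+-suc; +-comm)
  open import Data.Product using (_×_; _,_)
  open import Data.Vec using (Vec; []; _∷_; _∷ʳ_; _++_; here; there; tail; reverse; lookup; zipWith)
  open import Data.Vec.Properties
    using (tabulate∘lookup; tabulate-cong; lookup∘tabulate; lookup-zipWith; lookup⇒[]=;
           reverse-∷; reverse-++-eqFree; cast-is-id; ++-injective)
  open import Function.Bundles using (_⇔_; mk⇔)
  open import Relation.Nullary using (contradiction)
  open import Relation.Binary.PropositionalEquality using (_≡_; refl; sym; trans; cong; cong₂)
  open Relation.Binary.PropositionalEquality.≡-Reasoning

  private
    variable
      A : Set
      m n : ℕ

  lookup-extensional : (xs ys : Vec A n) → (∀ i → lookup xs i ≡ lookup ys i) → xs ≡ ys
  lookup-extensional xs ys eq = trans (sym (tabulate∘lookup xs)) (trans (tabulate-cong eq) (tabulate∘lookup ys))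

  lookup-reverse : (xs : Vec A n) (i : Fin n) → lookup (reverse xs) i ≡ lookup xs (opposite i)
  lookup-reverse xs i =
    trans (cong (lookup (reverse xs)) (sym (opposite-involutive i))) (lookup-reverse-opposite xs (opposite i))
    where
    lookup-∷ʳ-last : (ys : Vec A m) (x : A) → lookup (ys ∷ʳ x) (fromℕ m) ≡ x
    lookup-∷ʳ-last []       x = refl
    lookup-∷ʳ-last (y ∷ ys) x = lookup-∷ʳ-last ys x
    lookup-∷ʳ-inject₁ : (ys : Vec A m) (x : A) (i : Fin m) → lookup (ys ∷ʳ x) (inject₁ i) ≡ lookup ys i
    lookup-∷ʳ-inject₁ (y ∷ ys) x zero    = refl
    lookup-∷ʳ-inject₁ (y ∷ ys) x (suc i) = lookup-∷ʳ-inject₁ ys x i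
    lookup-reverse-opposite : (xs : Vec A m) (i : Fin m) → lookup (reverse xs) (opposite i) ≡ lookup xs i
    lookup-reverse-opposite (x ∷ xs) zero    =
      trans (cong (λ v → lookup v (opposite zero)) (reverse-∷ x xs)) (lookup-∷ʳ-last (reverse xs) x)
    lookup-reverse-opposite (x ∷ xs) (suc i) =
      trans (cong (λ v → lookup v (opposite (suc i))) (reverse-∷ x xs))
            (trans (lookup-∷ʳ-inject₁ (reverse xs) x (opposite i)) (lookup-reverse-opposite xs i))

  reflect≡reverse : (p : Subset n) → reflect p ≡ reverse p
  reflect≡reverse p = lookup-extensional _ _ λ i → trans (lookup∘tabulate _ i) (sym (lookup-reverse p i))

  reverse-++ : (xs ys : Vec A n) → reverse (xs ++ ys) ≡ reverse ys ++ reverse xs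
  reverse-++ {n = n} xs ys = trans (sym (cast-is-id (+-comm n n) _)) (reverse-++-eqFree xs ys)

  zipWith-reverse : (f : A → A → A) (xs ys : Vec A n) →
                    zipWith f (reverse xs) (reverse ys) ≡ reverse (zipWith f xs ys)
  zipWith-reverse f xs ys = lookup-extensional _ _ λ i → begin
    lookup (zipWith f (reverse xs) (reverse ys)) i       ≡⟨ lookup-zipWith f i (reverse xs) (reverse ys) ⟩
    f (lookup (reverse xs) i) (lookup (reverse ys) i)    ≡⟨ cong₂ f (lookup-reverse xs i) (lookup-reverse ys i) ⟩
    f (lookup xs (opposite i)) (lookup ys (opposite i))  ≡⟨ lookup-zipWith f (opposite i) xs ys ⟨
    lookup (zipWith f xs ys) (opposite i)                ≡⟨ lookup-reverse (zipWith f xs ys) i ⟨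
    lookup (reverse (zipWith f xs ys)) i                 ∎

  ++-≡⇔ : (p₁ q₁ : Vec A m) {p₂ q₂ : Vec A n} → (p₁ ++ p₂ ≡ q₁ ++ q₂) ⇔ (p₁ ≡ q₁ × p₂ ≡ q₂)
  ++-≡⇔ p₁ q₁ = mk⇔ (++-injective p₁ q₁) λ (p₁≡q₁ , p₂≡q₂) → cong₂ _++_ p₁≡q₁ p₂≡q₂

  ⊥-++ : ∀ m n → ⊥ {m + n} ≡ ⊥ {m} ++ ⊥ {n}
  ⊥-++ zero    n = refl
  ⊥-++ (suc m) n = cong (false ∷_) (⊥-++ m n)

  ∁-involutive : (p : Subset n) → ∁ (∁ p) ≡ p
  ∁-involutive []      = refl
  ∁-involutive (a ∷ p) = cong₂ _∷_ (not-involutive a) (∁-involutive p)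

  ∁-⊕ : (p q : Subset n) → ∁ p ⊕ ∁ q ≡ p ⊕ q
  ∁-⊕ []      []      = refl
  ∁-⊕ (a ∷ p) (b ∷ q) = cong₂ _∷_ (xor-annihilates-not a b) (∁-⊕ p q)

  △≡⊕ : (p q : Subset n) → p △ q ≡ p ⊕ q
  △≡⊕ []          []          = refl
  △≡⊕ (true  ∷ p) (true  ∷ q) = cong (false ∷_) (△≡⊕ p q)
  △≡⊕ (true  ∷ p) (false ∷ q) = cong (true ∷_) (△≡⊕ p q)
  △≡⊕ (false ∷ p) (true  ∷ q) = cong (true ∷_) (△≡⊕ p q)
  △≡⊕ (false ∷ p) (false ∷ q) = cong (false ∷_) (△≡⊕ p q)

  ∉⇒lookup≡false : {p : Subset n} {i : Fin n} → i ∉ p → lookup p i ≡ false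
  ∉⇒lookup≡false {p = p} {i} i∉p with lookup p i in p[i]
  ... | false = refl
  ... | true  = contradiction (lookup⇒[]= i p p[i]) i∉p

  lookup-─ : (p q : Subset n) (i : Fin n) → lookup p i ≡ true → lookup (p ─ q) i ≡ not (lookup q i)
  lookup-─ (true ∷ p) (true  ∷ q) zero    refl = refl
  lookup-─ (true ∷ p) (false ∷ q) zero    refl = refl
  lookup-─ (a    ∷ p) (b     ∷ q) (suc i) eq   = lookup-─ p q i eq

  x∉p-x : (p : Subset n) (x : Fin n) → x ∉ p - x
  x∉p-x (a ∷ p) zero    ()
  x∉p-x (a ∷ p) (suc x) (there x∈p-x) = x∉p-x p x x∈p-x

  ++-⊆⁻ : (p₁ q₁ : Subset m) {p₂ q₂ : Subset n} → p₁ ++ p₂ ⊆ q₁ ++ q₂ → p₁ ⊆ q₁ × p₂ ⊆ q₂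
  ++-⊆⁻ []       []       p⊆q = (λ ()) , p⊆q
  ++-⊆⁻ (a ∷ p₁) (b ∷ q₁) p⊆q with ++-⊆⁻ p₁ q₁ (drop-∷-⊆ p⊆q)
  ... | p₁⊆q₁ , p₂⊆q₂ = ∷-⊆ , p₂⊆q₂
    where
    ∷-⊆ : a ∷ p₁ ⊆ b ∷ q₁
    ∷-⊆ here with p⊆q here
    ... | here = here
    ∷-⊆ (there i∈p₁) = there (p₁⊆q₁ i∈p₁)

  ∣++∣ : (p : Subset m) (q : Subset n) → ∣ p ++ q ∣ ≡ ∣ p ∣ + ∣ q ∣
  ∣++∣ []          q = refl
  ∣++∣ (true  ∷ p) q = cong suc (∣++∣ p q)
  ∣++∣ (false ∷ p) q = ∣++∣ p q

  ∣reverse∣ : (p : Subset n) → ∣ reverse p ∣ ≡ ∣ p ∣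
  ∣reverse∣ []      = refl
  ∣reverse∣ (a ∷ p) = begin
    ∣ reverse (a ∷ p) ∣  ≡⟨ cong ∣_∣ (reverse-∷ a p) ⟩
    ∣ reverse p ∷ʳ a ∣   ≡⟨ ∣∷ʳ∣ (reverse p) a ⟩
    ∣ a ∷ reverse p ∣    ≡⟨ ∣∷∣-cong a {reverse p} {p} (∣reverse∣ p) ⟩
    ∣ a ∷ p ∣            ∎
    where
    ∣∷ʳ∣ : (q : Subset m) (a : Bool) → ∣ q ∷ʳ a ∣ ≡ ∣ a ∷ q ∣
    ∣∷ʳ∣ []          a     = refl
    ∣∷ʳ∣ (true  ∷ q) true  = cong suc (∣∷ʳ∣ q true)
    ∣∷ʳ∣ (true  ∷ q) false = cong suc (∣∷ʳ∣ q false)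
    ∣∷ʳ∣ (false ∷ q) a     = ∣∷ʳ∣ q a
    ∣∷∣-cong : ∀ a {q r : Subset m} → ∣ q ∣ ≡ ∣ r ∣ → ∣ a ∷ q ∣ ≡ ∣ a ∷ r ∣
    ∣∷∣-cong true  eq = cong suc eq
    ∣∷∣-cong false eq = eq

  ∣∪∣-disjoint : (p q : Subset n) → p ∩ q ≡ ⊥ → ∣ p ∪ q ∣ ≡ ∣ p ∣ + ∣ q ∣
  ∣∪∣-disjoint []          []          _  = refl
  ∣∪∣-disjoint (true  ∷ p) (true  ∷ q) ()
  ∣∪∣-disjoint (true  ∷ p) (false ∷ q) eq = cong suc (∣∪∣-disjoint p q (cong tail eq))
  ∣∪∣-disjoint (false ∷ p) (true  ∷ q) eq =
    trans (cong suc (∣∪∣-disjoint p q (cong tail eq))) (sym (+-suc ∣ p ∣ ∣ q ∣))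
  ∣∪∣-disjoint (false ∷ p) (false ∷ q) eq = ∣∪∣-disjoint p q (cong tail eq)

  ∣p∣≡1+∣p-x∣ : (p : Subset n) (x : Fin n) → x ∈ p → ∣ p ∣ ≡ suc ∣ p - x ∣
  ∣p∣≡1+∣p-x∣ (true  ∷ p) zero    here        = cong suc (sym (cong ∣_∣ (p─⊥≡p p)))
  ∣p∣≡1+∣p-x∣ (true  ∷ p) (suc x) (there x∈p) = cong suc (∣p∣≡1+∣p-x∣ p x x∈p)
  ∣p∣≡1+∣p-x∣ (false ∷ p) (suc x) (there x∈p) = ∣p∣≡1+∣p-x∣ p x x∈p

module Agreement where

  open LinearAlgebra using (_⊕_; lookup-⊕; ⊕-cancelʳ)
  open SubsetProperties using (lookup-reverse; lookup-extensional)
  open import Data.Bool using (true; false; not; _∧_; _xor_)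
  import Data.Bool as Bool
  open import Data.Bool.Properties using (not-involutive)
  open import Data.Fin using (opposite)
  open import Data.Fin.Subset using (Subset; ∁; _∪_; _∩_; _∈_; _⊆_)
  open import Data.Fin.Subset.Properties using (Lift?; x∈p∪q⁻)
  open import Data.Nat using (ℕ)
  open import Data.Sum using ([_,_]′)
  open import Data.Vec using (reverse; lookup)
  open import Data.Vec.Properties using (lookup-map; lookup-zipWith; []=⇒lookup; lookup⇒[]=; reverse-involutive)
  open import Function.Bundles using (_⇔_; mk⇔)
  open import Relation.Nullary using (Dec; contradiction)
  open import Relation.Nullary.Decidable using (map′)
  open import Relation.Binary.PropositionalEquality using (_≡_; refl; sym; trans; cong; subst; subst₂)
  open Relation.Binary.PropositionalEquality.≡-Reasoning

  private
    variable
      n : ℕ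
      w a v J K : Subset n

  infix 4 _≈[_]_ _≈[_]?_

  record _≈[_]_ (w J a : Subset n) : Set where
    constructor agree
    field
      at : ∀ {i} → i ∈ J → lookup w i ≡ lookup a i

  open _≈[_]_ public

  _≈[_]?_ : (w J a : Subset n) → Dec (w ≈[ J ] a)
  w ≈[ J ]? a = map′ agree at (Lift? (λ i → lookup w i Bool.≟ lookup a i) J)

  ≈-sym : w ≈[ J ] a → a ≈[ J ] w
  ≈-sym w≈a = agree λ i∈J → sym (at w≈a i∈J)

  ≈-trans : w ≈[ J ] v → v ≈[ J ] a → w ≈[ J ] a
  ≈-trans w≈v v≈a = agree λ i∈J → trans (at w≈v i∈J) (at v≈a i∈J)

  ≈-⊆ : K ⊆ J → w ≈[ J ] a → w ≈[ K ] a
  ≈-⊆ K⊆J w≈a = agree λ i∈K → at w≈a (K⊆J i∈K)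

  ≈-∪ : w ≈[ J ] a → w ≈[ K ] a → w ≈[ J ∪ K ] a
  ≈-∪ {J = J} {K = K} w≈J w≈K = agree λ i∈J∪K → [ at w≈J , at w≈K ]′ (x∈p∪q⁻ J K i∈J∪K)

  ≈-⊕ : w ≈[ J ] a → w ⊕ v ≈[ J ] a ⊕ v
  ≈-⊕ {w = w} {a = a} {v = v} w≈a = agree λ {i} i∈J →
    trans (lookup-⊕ w v i) (trans (cong (_xor lookup v i) (at w≈a i∈J)) (sym (lookup-⊕ a v i)))

  ≈-⊕⇔ : (w ⊕ v ≈[ J ] a) ⇔ (w ≈[ J ] a ⊕ v)
  ≈-⊕⇔ {w = w} {v = v} {a = a} = mk⇔
    (λ w⊕v≈a → subst (_≈[ _ ] a ⊕ v) (⊕-cancelʳ w v) (≈-⊕ w⊕v≈a))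
    (λ w≈a⊕v → subst (w ⊕ v ≈[ _ ]_) (⊕-cancelʳ a v) (≈-⊕ w≈a⊕v))

  ≈-∁⇔ : (∁ w ≈[ J ] a) ⇔ (w ≈[ J ] ∁ a)
  ≈-∁⇔ {w = w} {a = a} = mk⇔
    (λ ∁w≈a → agree λ {i} i∈J → begin
      lookup w i              ≡⟨ not-involutive (lookup w i) ⟨
      not (not (lookup w i))  ≡⟨ cong not (trans (sym (lookup-map i not w)) (at ∁w≈a i∈J)) ⟩
      not (lookup a i)        ≡⟨ lookup-map i not a ⟨
      lookup (∁ a) i          ∎)
    (λ w≈∁a → agree λ {i} i∈J → begin
      lookup (∁ w) i          ≡⟨ lookup-map i not w ⟩
      not (lookup w i)        ≡⟨ cong not (trans (at w≈∁a i∈J) (lookup-map i not a)) ⟩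
      not (not (lookup a i))  ≡⟨ not-involutive (lookup a i) ⟩
      lookup a i              ∎)

  ≈-reverse : w ≈[ J ] a → reverse w ≈[ reverse J ] reverse a
  ≈-reverse {w = w} {J = J} {a = a} w≈a = agree λ {i} i∈rJ →
    trans (lookup-reverse w i) (trans (at w≈a (opposite∈ i∈rJ)) (sym (lookup-reverse a i)))
    where
    opposite∈ : ∀ {i} → i ∈ reverse J → opposite i ∈ J
    opposite∈ {i} i∈rJ = lookup⇒[]= (opposite i) J (trans (sym (lookup-reverse J i)) ([]=⇒lookup i∈rJ))

  ≈-reverse⇔ : (reverse w ≈[ J ] a) ⇔ (w ≈[ reverse J ] reverse a)
  ≈-reverse⇔ {w = w} {J = J} {a = a} = mk⇔
    (λ rw≈a → subst (_≈[ reverse J ] reverse a) (reverse-involutive w) (≈-reverse rw≈a))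
    (λ w≈ra → subst₂ (reverse w ≈[_]_) (reverse-involutive J) (reverse-involutive a) (≈-reverse w≈ra))

  ∩≡⇔≈ : a ⊆ J → (J ∩ w ≡ a) ⇔ (w ≈[ J ] a)
  ∩≡⇔≈ {a = a} {J = J} {w = w} a⊆J = mk⇔ to from
    where
    to : J ∩ w ≡ a → w ≈[ J ] a
    to J∩w≡a = agree λ {i} i∈J → begin
      lookup w i               ≡⟨ cong (_∧ lookup w i) ([]=⇒lookup i∈J) ⟨
      lookup J i ∧ lookup w i  ≡⟨ lookup-zipWith _∧_ i J w ⟨
      lookup (J ∩ w) i         ≡⟨ cong (λ u → lookup u i) J∩w≡a ⟩
      lookup a i               ∎
    masked : w ≈[ J ] a → ∀ i → lookup J i ∧ lookup w i ≡ lookup a i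
    masked w≈a i with lookup J i in J[i] | lookup a i in a[i]
    ... | true  | _     = trans (at w≈a (lookup⇒[]= i J J[i])) a[i]
    ... | false | false = refl
    ... | false | true  = contradiction (trans (sym ([]=⇒lookup (a⊆J (lookup⇒[]= i a a[i])))) J[i]) λ ()
    from : w ≈[ J ] a → J ∩ w ≡ a
    from w≈a = lookup-extensional _ _ λ i → trans (lookup-zipWith _∧_ i J w) (masked w≈a i)

module Counting where

  open import Data.Bool using (Bool; true; false; _∧_; if_then_else_; _≟_)
  open import Data.Fin.Subset using (Subset)
  open import Data.List using (List; []; _∷_; _++_; map; filter; length)
  open import Data.List.Properties using (length-map; length-++; map-++; map-∘; filter-++)
  open import Data.List.Membership.Propositional using (_∈_)
  open import Data.List.Membership.Propositional.Properties using (∈-map⁺; ∈-map⁻; ∈-++⁺ˡ; ∈-++⁺ʳ)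
  open import Data.List.Relation.Binary.Disjoint.Propositional using (Disjoint)
  open import Data.List.Relation.Unary.Any using (here)
  open import Data.List.Relation.Unary.Unique.Propositional using (Unique; []; _∷_)
  import Data.List.Relation.Unary.Unique.Propositional.Properties as Unique
  open import Data.List.Relation.Unary.All using ([])
  open import Data.Nat using (ℕ; zero; suc; _+_; _^_)
  open import Data.Nat.Properties using (+-identityʳ; +-commutativeSemigroup)
  open import Algebra.Properties.CommutativeSemigroup +-commutativeSemigroup
    using () renaming (interchange to +-interchange)
  open import Data.Product using (_,_)
  open import Data.Vec using ([]; _∷_)
  open import Level using (0ℓ)
  open import Relation.Nullary using (does)
  open import Relation.Unary using (Pred; Decidable)
  open import Relation.Binary.PropositionalEquality using (_≡_; refl; sym; trans; cong; cong₂)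
  open Relation.Binary.PropositionalEquality.≡-Reasoning

  private
    variable
      m : ℕ

  indicator : Bool → ℕ
  indicator b = if b then 1 else 0

  count : (Subset m → Bool) → ℕ
  count {zero}  p = indicator (p [])
  count {suc m} p = count (λ x → p (false ∷ x)) + count (λ x → p (true ∷ x))

  count-cong : {p q : Subset m → Bool} → (∀ x → p x ≡ q x) → count p ≡ count q
  count-cong {zero}  p≗q = cong indicator (p≗q [])
  count-cong {suc m} p≗q = cong₂ _+_ (count-cong λ x → p≗q (false ∷ x)) (count-cong λ x → p≗q (true ∷ x))

  count-+ : {p q r : Subset m → Bool} → (∀ x → indicator (p x) + indicator (q x) ≡ indicator (r x)) →
            count p + count q ≡ count r
  count-+ {zero}          sum = sum []
  count-+ {suc m} {p} {q} sum = trans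
    (+-interchange (count (λ x → p (false ∷ x))) (count (λ x → p (true ∷ x)))
                   (count (λ x → q (false ∷ x))) (count (λ x → q (true ∷ x))))
    (cong₂ _+_ (count-+ λ x → sum (false ∷ x)) (count-+ λ x → sum (true ∷ x)))

  count-pivot : (f : Subset m → Bool) {p : Subset (suc m) → Bool} {q : Subset m → Bool} →
                (∀ β x → p (β ∷ x) ≡ does (β ≟ f x) ∧ q x) → count p ≡ count q
  count-pivot f p≗ = count-+ λ x →
    trans (cong₂ (λ b c → indicator b + indicator c) (p≗ false x) (p≗ true x)) (one-of (f x) _)
    where
    one-of : ∀ c b → indicator (does (false ≟ c) ∧ b) + indicator (does (true ≟ c) ∧ b) ≡ indicator b
    one-of false b = +-identityʳ (indicator b)
    one-of true  b = refl

  subsets : (m : ℕ) → List (Subset m)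
  subsets zero    = [] ∷ []
  subsets (suc m) = map (false ∷_) (subsets m) ++ map (true ∷_) (subsets m)

  length-subsets : ∀ m → length (subsets m) ≡ 2 ^ m
  length-subsets zero    = refl
  length-subsets (suc m) = begin
    length (map (false ∷_) (subsets m) ++ map (true ∷_) (subsets m))
      ≡⟨ length-++ (map (false ∷_) (subsets m)) ⟩
    length (map (false ∷_) (subsets m)) + length (map (true ∷_) (subsets m))
      ≡⟨ cong₂ _+_ (length-map _ (subsets m)) (length-map _ (subsets m)) ⟩
    length (subsets m) + length (subsets m)
      ≡⟨ cong₂ _+_ (length-subsets m) (trans (length-subsets m) (sym (+-identityʳ (2 ^ m)))) ⟩
    2 ^ suc m
      ∎

  ∈-subsets : (x : Subset m) → x ∈ subsets m
  ∈-subsets []          = here refl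
  ∈-subsets (false ∷ x) = ∈-++⁺ˡ (∈-map⁺ (false ∷_) (∈-subsets x))
  ∈-subsets (true  ∷ x) = ∈-++⁺ʳ (map (false ∷_) (subsets _)) (∈-map⁺ (true ∷_) (∈-subsets x))

  subsets-unique : ∀ m → Unique (subsets m)
  subsets-unique zero    = [] ∷ []
  subsets-unique (suc m) =
    Unique.++⁺ (Unique.map⁺ ∷-injectiveʳ (subsets-unique m)) (Unique.map⁺ ∷-injectiveʳ (subsets-unique m))
               heads-differ
    where
    ∷-injectiveʳ : ∀ {b} {x y : Subset m} → b ∷ x ≡ b ∷ y → x ≡ y
    ∷-injectiveʳ refl = refl
    heads-differ : Disjoint (map (false ∷_) (subsets m)) (map (true ∷_) (subsets m))
    heads-differ (v∈₀ , v∈₁) with ∈-map⁻ (false ∷_) v∈₀ | ∈-map⁻ (true ∷_) v∈₁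
    ... | _ , _ , refl | _ , _ , ()

  length-filter-subsets : {A : Set} {P : Pred A 0ℓ} (P? : Decidable P) (f : Subset m → A) →
                          length (filter P? (map f (subsets m))) ≡ count (λ x → does (P? (f x)))
  length-filter-subsets {zero}  P? f with does (P? (f []))
  ... | true  = refl
  ... | false = refl
  length-filter-subsets {suc m} P? f = begin
    length (filter P? (map f (map (false ∷_) (subsets m) ++ map (true ∷_) (subsets m))))
      ≡⟨ cong (λ xs → length (filter P? xs)) (map-++ f (map (false ∷_) (subsets m)) _) ⟩
    length (filter P? (map f (map (false ∷_) (subsets m)) ++ map f (map (true ∷_) (subsets m))))
      ≡⟨ cong length (filter-++ P? (map f (map (false ∷_) (subsets m))) _) ⟩
    length (filter P? (map f (map (false ∷_) (subsets m))) ++ filter P? (map f (map (true ∷_) (subsets m))))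
      ≡⟨ length-++ (filter P? (map f (map (false ∷_) (subsets m)))) ⟩
    length (filter P? (map f (map (false ∷_) (subsets m)))) + length (filter P? (map f (map (true ∷_) (subsets m))))
      ≡⟨ cong₂ _+_ (half false) (half true) ⟩
    count (λ x → does (P? (f x)))
      ∎
    where
    half : ∀ b → length (filter P? (map f (map (b ∷_) (subsets m)))) ≡ count (λ x → does (P? (f (b ∷ x))))
    half b = trans (cong (λ xs → length (filter P? xs)) (sym (map-∘ (subsets m))))
                   (length-filter-subsets P? (λ x → f (b ∷ x)))

module GaussianElimination where

  open LinearAlgebra
  open Agreement
  open Counting using (count; count-cong; count-pivot; indicator)
  open SubsetProperties using (∣p∣≡1+∣p-x∣; x∉p-x)
  open import Data.Bool using (Bool; true; false; _∧_; _xor_; _≟_)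
  open import Data.Bool.Properties using (∧-identityʳ; ∧-zeroʳ; xor-same)
  open import Data.Bool.Solver using (module xor-∧-Solver)
  open import Data.Fin using (Fin) renaming (_≟_ to _≟ᶠ_)
  open import Data.Fin.Subset using (Subset; ⊥; ⁅_⁆; _∩_; _∈_; _⊆_; _-_; ∣_∣)
  open import Data.Fin.Subset.Properties
    using (nonempty?; x∈p∩q⁺; x∈p∩q⁻; ∉⊥; ∣⊥∣≡0; p─q⊆p; x∈p∧x≢y⇒x∈p-y; x∈⁅x⁆; x∈⁅y⁆⇒x≡y)
  open import Data.Nat using (ℕ; zero; suc; _+_; _*_; _^_)
  open import Data.Nat.Properties using (*-distribʳ-+; *-assoc; *-comm; +-identityʳ)
  open import Data.Product using (_×_; _,_; proj₁; proj₂)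
  open import Data.Vec using (Vec; []; _∷_; map; lookup; head; tail)
  open import Data.Vec.Properties using (lookup-map; []=⇒lookup; lookup⇒[]=)
  open import Function.Bundles using (_⇔_; mk⇔; Equivalence)
  open import Relation.Nullary using (does; yes; no; _×-dec_; contradiction)
  open import Relation.Nullary.Decidable using (does-⇔; dec-true)
  open import Relation.Binary.PropositionalEquality using (_≡_; refl; sym; trans; cong; cong₂; subst)
  open Relation.Binary.PropositionalEquality.≡-Reasoning

  private
    variable
      k m : ℕ

  IndependentOn : Subset k → Vec (Subset m) k → Set
  IndependentOn J G = ∀ u → u ⊆ J → u ⊛ G ≡ ⊥ → u ≡ ⊥

  #solutions : Vec (Subset m) k → Subset k → Subset k → ℕ
  #solutions G J b = count (λ x → does (encode G x ≈[ J ]? b))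

  same-residual : ∀ {a b c d} → a xor b ≡ c xor d → (a ≡ b) ⇔ (c ≡ d)
  same-residual {a} {b} {c} {d} eq =
    mk⇔ (λ a≡b → from-residual c d (trans (sym eq) (to-residual a b a≡b)))
        (λ c≡d → from-residual a b (trans eq (to-residual c d c≡d)))
    where
    to-residual : ∀ x y → x ≡ y → x xor y ≡ false
    to-residual x y refl = xor-same x
    from-residual : ∀ x y → x xor y ≡ false → x ≡ y
    from-residual true  true  _ = refl
    from-residual false false _ = refl

  lookup-encode-∷ : (G : Vec (Subset (suc m)) k) (β : Bool) (x : Subset m) (i : Fin k) →
    lookup (encode G (β ∷ x)) i ≡ (β ∧ lookup (map head G) i) xor lookup (encode (map tail G) x) i
  lookup-encode-∷ G β x i = begin
    lookup (encode G (β ∷ x)) i                                        ≡⟨ lookup-map i _ G ⟩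
    (β ∷ x) ∙ lookup G i                                               ≡⟨ ∙-∷ β x (lookup G i) ⟩
    (β ∧ head (lookup G i)) xor x ∙ tail (lookup G i)                  ≡⟨ cong₂ (λ c t → (β ∧ c) xor x ∙ t)
                                                                            (lookup-map i head G) (lookup-map i tail G) ⟨
    (β ∧ lookup (map head G) i) xor x ∙ lookup (map tail G) i          ≡⟨ cong ((β ∧ lookup (map head G) i) xor_)
                                                                            (lookup-map i _ (map tail G)) ⟨
    (β ∧ lookup (map head G) i) xor lookup (encode (map tail G) x) i   ∎

  module FreeColumn (G : Vec (Subset (suc m)) k) (J : Subset k)
                    (free : ∀ {i} → i ∈ J → lookup (map head G) i ≡ false) where

    solutions : ∀ b β x → does (encode G (β ∷ x) ≈[ J ]? b) ≡ does (encode (map tail G) x ≈[ J ]? b)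
    solutions b β x = does-⇔ (mk⇔ (≈-trans (≈-sym same)) (≈-trans same))
                             (encode G (β ∷ x) ≈[ J ]? b) (encode (map tail G) x ≈[ J ]? b)
      where
      y : Subset k
      y = encode (map tail G) x
      same : encode G (β ∷ x) ≈[ J ] y
      same = agree λ {i} i∈J → begin
        lookup (encode G (β ∷ x)) i                   ≡⟨ lookup-encode-∷ G β x i ⟩
        (β ∧ lookup (map head G) i) xor lookup y i    ≡⟨ cong (λ c → (β ∧ c) xor lookup y i) (free i∈J) ⟩
        (β ∧ false) xor lookup y i                    ≡⟨ cong (_xor lookup y i) (∧-zeroʳ β) ⟩
        lookup y i                                    ∎

    independent : IndependentOn J G → IndependentOn J (map tail G)
    independent ind u u⊆J u⊛T≡⊥ = ind u u⊆J (begin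
      u ⊛ G                               ≡⟨ ⊛-head-tail u G ⟩
      u ∙ map head G ∷ u ⊛ map tail G     ≡⟨ cong₂ _∷_ (∙-vanishes u _ λ i∈u → free (u⊆J i∈u)) u⊛T≡⊥ ⟩
      ⊥                                   ∎)

  -- Equation j determines the first unknown β. Substituting it into equation i adds head Gᵢ times
  -- equation j, i.e. replaces column Gᵢ by tail Gᵢ ⊕ head Gᵢ · tail Gⱼ and bᵢ by bᵢ ⊕ head Gᵢ ∧ bⱼ.
  module PivotColumn (G : Vec (Subset (suc m)) k) (J : Subset k) (j : Fin k)
                     (j∈J : j ∈ J) (pivot : lookup (map head G) j ≡ true) where

    private
      h : Subset k
      h = map head G
      y : Subset m → Subset k
      y = encode (map tail G)

    eliminated : Vec (Subset m) k
    eliminated = map (λ c → tail c ⊕ head c · lookup (map tail G) j) G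

    eliminatedRhs : Subset k → Subset k
    eliminatedRhs b = b ⊕ lookup b j · h

    pivotValue : Subset k → Subset m → Bool
    pivotValue b x = lookup b j xor lookup (y x) j

    lookup-eliminated : ∀ x i → lookup (encode eliminated x) i ≡ lookup (y x) i xor (lookup h i ∧ lookup (y x) j)
    lookup-eliminated x i = begin
      lookup (encode eliminated x) i                          ≡⟨ lookup-map i _ eliminated ⟩
      x ∙ lookup eliminated i                                 ≡⟨ cong (x ∙_) (lookup-map i _ G) ⟩
      x ∙ (tail (lookup G i) ⊕ head (lookup G i) · g)         ≡⟨ ∙-distribˡ-⊕ x _ _ ⟩
      x ∙ tail (lookup G i) xor x ∙ (head (lookup G i) · g)   ≡⟨ cong (x ∙ tail (lookup G i) xor_)
                                                                       (∙-· (head (lookup G i)) x g) ⟩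
      x ∙ tail (lookup G i) xor (head (lookup G i) ∧ x ∙ g)   ≡⟨ cong₂ (λ t c → x ∙ t xor (c ∧ x ∙ g))
                                                                       (lookup-map i tail G) (lookup-map i head G) ⟨
      x ∙ lookup (map tail G) i xor (lookup h i ∧ x ∙ g)      ≡⟨ cong₂ (λ yᵢ yⱼ → yᵢ xor (lookup h i ∧ yⱼ))
                                                                       (lookup-map i _ (map tail G))
                                                                       (lookup-map j _ (map tail G)) ⟨
      lookup (y x) i xor (lookup h i ∧ lookup (y x) j)        ∎
      where
      g : Subset m
      g = lookup (map tail G) j

    lookup-eliminatedRhs : ∀ b i → lookup (eliminatedRhs b) i ≡ lookup b i xor (lookup b j ∧ lookup h i)
    lookup-eliminatedRhs b i = trans (lookup-⊕ b _ i) (cong (lookup b i xor_) (lookup-· (lookup b j) h i))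

    module _ (b : Subset k) (β : Bool) (x : Subset m) where

      reduced-row : ∀ {i} → β ≡ pivotValue b x →
        (lookup (encode G (β ∷ x)) i ≡ lookup b i) ⇔ (lookup (encode eliminated x) i ≡ lookup (eliminatedRhs b) i)
      reduced-row {i} refl = same-residual (begin
        lookup (encode G (β ∷ x)) i xor bᵢ
          ≡⟨ cong (_xor bᵢ) (lookup-encode-∷ G β x i) ⟩
        ((β ∧ hᵢ) xor yᵢ) xor bᵢ
          ≡⟨ substitute bⱼ yⱼ hᵢ yᵢ bᵢ ⟩
        (yᵢ xor (hᵢ ∧ yⱼ)) xor (bᵢ xor (bⱼ ∧ hᵢ))
          ≡⟨ cong₂ _xor_ (lookup-eliminated x i) (lookup-eliminatedRhs b i) ⟨
        lookup (encode eliminated x) i xor lookup (eliminatedRhs b) i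
          ∎)
        where
        bᵢ bⱼ hᵢ yᵢ yⱼ : Bool
        bᵢ = lookup b i
        bⱼ = lookup b j
        hᵢ = lookup h i
        yᵢ = lookup (y x) i
        yⱼ = lookup (y x) j
        open xor-∧-Solver
        substitute : ∀ bⱼ yⱼ hᵢ yᵢ bᵢ → (((bⱼ xor yⱼ) ∧ hᵢ) xor yᵢ) xor bᵢ ≡ (yᵢ xor (hᵢ ∧ yⱼ)) xor (bᵢ xor (bⱼ ∧ hᵢ))
        substitute = solve 5 (λ bⱼ yⱼ hᵢ yᵢ bᵢ →
          (((bⱼ :+ yⱼ) :* hᵢ) :+ yᵢ) :+ bᵢ := (yᵢ :+ (hᵢ :* yⱼ)) :+ (bᵢ :+ (bⱼ :* hᵢ))) refl

      pivot-row : (lookup (encode G (β ∷ x)) j ≡ lookup b j) ⇔ (β ≡ pivotValue b x)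
      pivot-row = same-residual (begin
        lookup (encode G (β ∷ x)) j xor bⱼ   ≡⟨ cong (_xor bⱼ) (lookup-encode-∷ G β x j) ⟩
        ((β ∧ lookup h j) xor yⱼ) xor bⱼ     ≡⟨ cong (λ c → ((β ∧ c) xor yⱼ) xor bⱼ) pivot ⟩
        ((β ∧ true) xor yⱼ) xor bⱼ           ≡⟨ cong (λ c → (c xor yⱼ) xor bⱼ) (∧-identityʳ β) ⟩
        (β xor yⱼ) xor bⱼ                    ≡⟨ solve 3 (λ β yⱼ bⱼ → (β :+ yⱼ) :+ bⱼ := β :+ (bⱼ :+ yⱼ)) refl β yⱼ bⱼ ⟩
        β xor (bⱼ xor yⱼ)                    ∎)
        where
        open xor-∧-Solver
        bⱼ yⱼ : Bool
        bⱼ = lookup b j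
        yⱼ = lookup (y x) j

      solutions⇔ : encode G (β ∷ x) ≈[ J ] b ⇔ (β ≡ pivotValue b x × encode eliminated x ≈[ J - j ] eliminatedRhs b)
      solutions⇔ = mk⇔ to from
        where
        to : encode G (β ∷ x) ≈[ J ] b → β ≡ pivotValue b x × encode eliminated x ≈[ J - j ] eliminatedRhs b
        to E = β≡ , agree λ i∈J-j → Equivalence.to (reduced-row β≡) (at E (p─q⊆p J ⁅ j ⁆ i∈J-j))
          where
          β≡ : β ≡ pivotValue b x
          β≡ = Equivalence.to pivot-row (at E j∈J)
        from : β ≡ pivotValue b x × encode eliminated x ≈[ J - j ] eliminatedRhs b → encode G (β ∷ x) ≈[ J ] b
        from (β≡ , E) = agree row
          where
          row : ∀ {i} → i ∈ J → lookup (encode G (β ∷ x)) i ≡ lookup b i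
          row {i} i∈J with i ≟ᶠ j
          ... | yes refl = Equivalence.from pivot-row β≡
          ... | no  i≢j  = Equivalence.from (reduced-row β≡) (at E (x∈p∧x≢y⇒x∈p-y i∈J i≢j))

      solutions : does (encode G (β ∷ x) ≈[ J ]? b) ≡
                  does (β ≟ pivotValue b x) ∧ does (encode eliminated x ≈[ J - j ]? eliminatedRhs b)
      solutions = does-⇔ solutions⇔ (encode G (β ∷ x) ≈[ J ]? b)
                         ((β ≟ pivotValue b x) ×-dec (encode eliminated x ≈[ J - j ]? eliminatedRhs b))

    -- A combination u of the eliminated columns is the combination `lifted` of the original ones,
    -- whose coefficient at j is chosen to cancel the first coordinate.
    independent : IndependentOn J G → IndependentOn (J - j) eliminated
    independent ind u u⊆J-j u⊛E≡⊥ = conclude c (⊕≡⊥⇒≡ u (c · ⁅ j ⁆) (ind lifted lifted⊆J lifted⊛G≡⊥))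
      where
      c : Bool
      c = u ∙ h
      lifted : Subset k
      lifted = u ⊕ c · ⁅ j ⁆
      lifted⊆J : lifted ⊆ J
      lifted⊆J = ⊕-⊆ (λ i∈u → p─q⊆p J ⁅ j ⁆ (u⊆J-j i∈u))
                     (λ i∈c·⁅j⁆ → subst (_∈ J) (sym (x∈⁅y⁆⇒x≡y j (·-⊆ c i∈c·⁅j⁆))) j∈J)
      lifted∙h≡false : lifted ∙ h ≡ false
      lifted∙h≡false = begin
        (u ⊕ c · ⁅ j ⁆) ∙ h      ≡⟨ ∙-distribʳ-⊕ u (c · ⁅ j ⁆) h ⟩
        c xor (c · ⁅ j ⁆) ∙ h    ≡⟨ cong (c xor_) (trans (·-∙ c ⁅ j ⁆ h) (cong (c ∧_) (⁅⁆-∙ j h))) ⟩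
        c xor (c ∧ lookup h j)   ≡⟨ cong (λ p → c xor (c ∧ p)) pivot ⟩
        c xor (c ∧ true)         ≡⟨ cong (c xor_) (∧-identityʳ c) ⟩
        c xor c                  ≡⟨ xor-same c ⟩
        false                    ∎
      lifted⊛T≡⊥ : lifted ⊛ map tail G ≡ ⊥
      lifted⊛T≡⊥ = begin
        (u ⊕ c · ⁅ j ⁆) ⊛ map tail G                  ≡⟨ ⊛-distribʳ-⊕ u (c · ⁅ j ⁆) (map tail G) ⟩
        u ⊛ map tail G ⊕ (c · ⁅ j ⁆) ⊛ map tail G     ≡⟨ cong (u ⊛ map tail G ⊕_) (·-⊛ c ⁅ j ⁆ (map tail G)) ⟩
        u ⊛ map tail G ⊕ c · (⁅ j ⁆ ⊛ map tail G)     ≡⟨ cong (λ w → u ⊛ map tail G ⊕ c · w) (⁅⁆-⊛ j (map tail G)) ⟩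
        u ⊛ map tail G ⊕ c · lookup (map tail G) j    ≡⟨ ⊛-eliminate u (lookup (map tail G) j) G ⟨
        u ⊛ eliminated                                ≡⟨ u⊛E≡⊥ ⟩
        ⊥                                             ∎
      lifted⊛G≡⊥ : lifted ⊛ G ≡ ⊥
      lifted⊛G≡⊥ = trans (⊛-head-tail lifted G) (cong₂ _∷_ lifted∙h≡false lifted⊛T≡⊥)
      conclude : ∀ c → u ≡ c · ⁅ j ⁆ → u ≡ ⊥
      conclude false u≡⊥    = u≡⊥
      conclude true  u≡⁅j⁆ = contradiction (u⊆J-j (subst (j ∈_) (sym u≡⁅j⁆) (x∈⁅x⁆ j))) (x∉p-x J j)

  solutions-count : ∀ m {k} (G : Vec (Subset m) k) (J b : Subset k) → IndependentOn J G →
                    #solutions G J b * 2 ^ ∣ J ∣ ≡ 2 ^ m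
  solutions-count zero {k} G J b ind with ind J (λ i∈J → i∈J) (no-bits (J ⊛ G))
    where
    no-bits : (v : Subset 0) → v ≡ ⊥
    no-bits [] = refl
  ... | refl = cong₂ (λ c w → indicator c * 2 ^ w)
                     (dec-true (encode G [] ≈[ ⊥ ]? b) (agree λ i∈⊥ → contradiction i∈⊥ ∉⊥))
                     (∣⊥∣≡0 k)
  solutions-count (suc m) G J b ind with nonempty? (J ∩ map head G)
  ... | no no-pivot = begin
    #solutions G J b * 2 ^ ∣ J ∣    ≡⟨ cong (_* 2 ^ ∣ J ∣) (cong₂ _+_ (count-cong (Free.solutions b false))
                                                                       (count-cong (Free.solutions b true))) ⟩
    (s + s) * 2 ^ ∣ J ∣             ≡⟨ *-distribʳ-+ (2 ^ ∣ J ∣) s s ⟩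
    s * 2 ^ ∣ J ∣ + s * 2 ^ ∣ J ∣   ≡⟨ cong₂ _+_ IH (trans IH (sym (+-identityʳ (2 ^ m)))) ⟩
    2 ^ suc m                       ∎
    where
    free : ∀ {i} → i ∈ J → lookup (map head G) i ≡ false
    free {i} i∈J with lookup (map head G) i in h[i]
    ... | false = refl
    ... | true  = contradiction (i , x∈p∩q⁺ (i∈J , lookup⇒[]= i _ h[i])) no-pivot
    module Free = FreeColumn G J free
    s : ℕ
    s = #solutions (map tail G) J b
    IH : s * 2 ^ ∣ J ∣ ≡ 2 ^ m
    IH = solutions-count m (map tail G) J b (Free.independent ind)
  ... | yes (j , j∈J∩h) = begin
    #solutions G J b * 2 ^ ∣ J ∣   ≡⟨ cong₂ _*_ (count-pivot (P.pivotValue b) {p = λ y → does (encode G y ≈[ J ]? b)}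
                                                             (P.solutions b))
                                                (cong (2 ^_) (∣p∣≡1+∣p-x∣ J j j∈J)) ⟩
    s * (2 * 2 ^ ∣ J - j ∣)        ≡⟨ *-assoc s 2 _ ⟨
    s * 2 * 2 ^ ∣ J - j ∣          ≡⟨ cong (_* 2 ^ ∣ J - j ∣) (*-comm s 2) ⟩
    2 * s * 2 ^ ∣ J - j ∣          ≡⟨ *-assoc 2 s _ ⟩
    2 * (s * 2 ^ ∣ J - j ∣)        ≡⟨ cong (2 *_) IH ⟩
    2 ^ suc m                      ∎
    where
    j∈J : j ∈ J
    j∈J = proj₁ (x∈p∩q⁻ J (map head G) j∈J∩h)
    module P = PivotColumn G J j j∈J ([]=⇒lookup (proj₂ (x∈p∩q⁻ J (map head G) j∈J∩h)))
    s : ℕ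
    s = #solutions P.eliminated (J - j) (P.eliminatedRhs b)
    IH : s * 2 ^ ∣ J - j ∣ ≡ 2 ^ m
    IH = solutions-count m P.eliminated (J - j) (P.eliminatedRhs b) (P.independent ind)

module HammingBall where

  open import Data.Bool using (Bool; true; false)
  open import Data.Fin.Subset using (Subset; ∣_∣)
  open import Data.List using (List; []; _∷_; _++_; map; length)
  open import Data.List.Properties using (length-map; length-++)
  open import Data.List.Membership.Propositional using (_∈_; _∉_)
  open import Data.List.Membership.Propositional.Properties using (∈-map⁺; ∈-++⁺ˡ; ∈-++⁺ʳ)
  open import Data.List.Relation.Unary.Any using (here; there)
  open import Data.Nat using (ℕ; zero; suc; _+_; _*_; _^_; _≤_; _<_; s≤s; _<?_; s≤s⁻¹)
  open import Data.Nat.Properties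
    using (≤-refl; m≤m+n; n≤1+n; m≤m*n; +-identityʳ; *-identityʳ; +-suc; +-mono-≤; +-monoˡ-≤; *-monoʳ-≤;
           +-cancelˡ-<; *-cancelʳ-<; ^-monoˡ-≤; ^-monoʳ-≤; ^-monoˡ-<; ^-*-assoc; *-assoc; *-comm;
           m^n>0; <ᵇ⇒<; ≰⇒>; <⇒≱; ≮⇒≥; ≤-<-trans; module ≤-Reasoning)
  open import Data.Nat.Tactic.RingSolver using (solve-∀)
  open import Data.Product using (∃; _,_)
  open import Data.Unit using (tt)
  open import Data.Vec using ([]; _∷_)
  open import Relation.Nullary using (yes; no)
  open import Relation.Binary.PropositionalEquality using (_≡_; refl; sym; trans; cong; cong₂; subst; subst₂)

  ball : (n t : ℕ) → List (Subset n)
  ball zero    t       = [] ∷ []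
  ball (suc n) zero    = map (false ∷_) (ball n zero)
  ball (suc n) (suc t) = map (false ∷_) (ball n (suc t)) ++ map (true ∷_) (ball n t)

  volume : ℕ → ℕ → ℕ
  volume zero    t       = 1
  volume (suc n) zero    = volume n zero
  volume (suc n) (suc t) = volume n (suc t) + volume n t

  length-ball : ∀ n t → length (ball n t) ≡ volume n t
  length-ball zero    t       = refl
  length-ball (suc n) zero    = trans (length-map _ (ball n zero)) (length-ball n zero)
  length-ball (suc n) (suc t) = trans (length-++ (map (false ∷_) (ball n (suc t))))
    (cong₂ _+_ (trans (length-map _ (ball n (suc t))) (length-ball n (suc t)))
               (trans (length-map _ (ball n t)) (length-ball n t)))

  ∈-ball : ∀ {n} t (w : Subset n) → ∣ w ∣ ≤ t → w ∈ ball n t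
  ∈-ball t       []          _        = here refl
  ∈-ball zero    (false ∷ w) ∣w∣≤0    = ∈-map⁺ (false ∷_) (∈-ball zero w ∣w∣≤0)
  ∈-ball (suc t) (false ∷ w) ∣w∣≤1+t  = ∈-++⁺ˡ (∈-map⁺ (false ∷_) (∈-ball (suc t) w ∣w∣≤1+t))
  ∈-ball (suc t) (true  ∷ w) ∣w∣<1+t  =
    ∈-++⁺ʳ (map (false ∷_) (ball _ (suc t))) (∈-map⁺ (true ∷_) (∈-ball t w (s≤s⁻¹ ∣w∣<1+t)))

  volume-mono : ∀ n t → volume n t ≤ volume (suc n) t
  volume-mono n zero    = ≤-refl
  volume-mono n (suc t) = m≤m+n (volume n (suc t)) (volume n t)

  volume-zero : ∀ n → volume n zero ≡ 1
  volume-zero zero    = refl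
  volume-zero (suc n) = volume-zero n

  -- volume n t ≤ (1 + x)ⁿ / xᵗ at x = 1/9
  volume-bound : ∀ n t → volume n t * 9 ^ n ≤ 10 ^ n * 9 ^ t
  volume-bound zero    t       = subst (1 ≤_) (sym (+-identityʳ (9 ^ t))) (m^n>0 9 t)
  volume-bound (suc n) zero    rewrite volume-zero n =
    subst₂ _≤_ (sym (+-identityʳ (9 ^ suc n))) (sym (*-identityʳ (10 ^ suc n))) (^-monoˡ-≤ (suc n) (n≤1+n 9))
  volume-bound (suc n) (suc t) = begin
    (volume n (suc t) + volume n t) * (9 * 9 ^ n)
      ≡⟨ split (volume n (suc t)) (volume n t) (9 ^ n) ⟩
    9 * (volume n (suc t) * 9 ^ n) + 9 * (volume n t * 9 ^ n)
      ≤⟨ +-mono-≤ (*-monoʳ-≤ 9 (volume-bound n (suc t))) (*-monoʳ-≤ 9 (volume-bound n t)) ⟩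
    9 * (10 ^ n * (9 * 9 ^ t)) + 9 * (10 ^ n * 9 ^ t)
      ≡⟨ merge (10 ^ n) (9 ^ t) ⟩
    10 * 10 ^ n * (9 * 9 ^ t)
      ∎
    where
    open ≤-Reasoning
    split : ∀ a b c → (a + b) * (9 * c) ≡ 9 * (a * c) + 9 * (b * c)
    split = solve-∀
    merge : ∀ x y → 9 * (x * (9 * y)) + 9 * (x * y) ≡ 10 * x * (9 * y)
    merge = solve-∀

  ^-distribʳ-* : ∀ x y e → (x * y) ^ e ≡ x ^ e * y ^ e
  ^-distribʳ-* x y zero    = refl
  ^-distribʳ-* x y (suc e) = trans (cong (x * y *_) (^-distribʳ-* x y e)) (swap x y (x ^ e) (y ^ e))
    where
    swap : ∀ a b c d → a * b * (c * d) ≡ a * c * (b * d)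
    swap = solve-∀

  ^-regroup : ∀ a b c d e → b * c ≡ d * e → (a ^ b) ^ c ≡ (a ^ d) ^ e
  ^-regroup a b c d e bc≡de = trans (^-*-assoc a b c) (trans (cong (a ^_) bc≡de) (sym (^-*-assoc a d e)))

  ^-cancelʳ-< : ∀ e {x y} → x ^ e < y ^ e → x < y
  ^-cancelʳ-< e xᵉ<yᵉ = ≰⇒> λ y≤x → <⇒≱ xᵉ<yᵉ (^-monoˡ-≤ e y≤x)

  -- By volume-bound it suffices that (10²ᵐ 9ᵗ)⁵ < (2ᵐ 9²ᵐ)⁵, which follows from 10¹⁰ · 9 < 2⁵ · 9¹⁰.
  volume-small : ∀ m t → 1 ≤ m → 5 * t < m → volume (m + m) t < 2 ^ m
  volume-small m@(suc _) t _ 5t<m =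
    *-cancelʳ-< (9 ^ (m + m)) _ _ (≤-<-trans (volume-bound (m + m) t) (^-cancelʳ-< 5 X⁵<Y⁵))
    where
    open ≤-Reasoning
    X⁵<Y⁵ : (10 ^ (m + m) * 9 ^ t) ^ 5 < (2 ^ m * 9 ^ (m + m)) ^ 5
    X⁵<Y⁵ = begin-strict
      (10 ^ (m + m) * 9 ^ t) ^ 5            ≤⟨ m≤m*n _ 9 ⟩
      (10 ^ (m + m) * 9 ^ t) ^ 5 * 9        ≡⟨ cong (_* 9) (^-distribʳ-* (10 ^ (m + m)) (9 ^ t) 5) ⟩
      (10 ^ (m + m)) ^ 5 * (9 ^ t) ^ 5 * 9  ≡⟨ cong₂ (λ a b → a * b * 9) (^-regroup 10 (m + m) 5 10 m (ten m))
                                                                       (^-*-assoc 9 t 5) ⟩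
      (10 ^ 10) ^ m * 9 ^ (t * 5) * 9       ≡⟨ *-assoc ((10 ^ 10) ^ m) (9 ^ (t * 5)) 9 ⟩
      (10 ^ 10) ^ m * (9 ^ (t * 5) * 9)     ≡⟨ cong ((10 ^ 10) ^ m *_) (*-comm (9 ^ (t * 5)) 9) ⟩
      (10 ^ 10) ^ m * 9 ^ suc (t * 5)       ≤⟨ *-monoʳ-≤ ((10 ^ 10) ^ m) (^-monoʳ-≤ 9 t*5<m) ⟩
      (10 ^ 10) ^ m * 9 ^ m                 ≡⟨ ^-distribʳ-* (10 ^ 10) 9 m ⟨
      (10 ^ 10 * 9) ^ m                     <⟨ ^-monoˡ-< m (<ᵇ⇒< (10 ^ 10 * 9) (2 ^ 5 * 9 ^ 10) tt) ⟩
      (2 ^ 5 * 9 ^ 10) ^ m                  ≡⟨ ^-distribʳ-* (2 ^ 5) (9 ^ 10) m ⟩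
      (2 ^ 5) ^ m * (9 ^ 10) ^ m            ≡⟨ cong₂ _*_ (^-regroup 2 5 m m 5 (*-comm 5 m))
                                                         (^-regroup 9 10 m (m + m) 5 (sym (ten m))) ⟩
      (2 ^ m) ^ 5 * (9 ^ (m + m)) ^ 5       ≡⟨ ^-distribʳ-* (2 ^ m) (9 ^ (m + m)) 5 ⟨
      (2 ^ m * 9 ^ (m + m)) ^ 5             ∎
      where
      ten : ∀ m → (m + m) * 5 ≡ 10 * m
      ten = solve-∀
      t*5<m : t * 5 < m
      t*5<m = subst (_< m) (*-comm 5 t) 5t<m

  tailsWith : ∀ {n} → Bool → List (Subset (suc n)) → List (Subset n)
  tailsWith b     []                = []
  tailsWith false ((false ∷ v) ∷ L) = v ∷ tailsWith false L
  tailsWith false ((true  ∷ v) ∷ L) = tailsWith false L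
  tailsWith true  ((false ∷ v) ∷ L) = tailsWith true L
  tailsWith true  ((true  ∷ v) ∷ L) = v ∷ tailsWith true L

  length-tailsWith : ∀ {n} (L : List (Subset (suc n))) →
                     length (tailsWith false L) + length (tailsWith true L) ≡ length L
  length-tailsWith []                = refl
  length-tailsWith ((false ∷ v) ∷ L) = cong suc (length-tailsWith L)
  length-tailsWith ((true  ∷ v) ∷ L) = trans (+-suc _ _) (cong suc (length-tailsWith L))

  ∈-tailsWith : ∀ {n} b {v : Subset n} {L} → b ∷ v ∈ L → v ∈ tailsWith b L
  ∈-tailsWith false {L = (false ∷ w) ∷ L} (here refl) = here refl
  ∈-tailsWith true  {L = (true  ∷ w) ∷ L} (here refl) = here refl
  ∈-tailsWith false {L = (false ∷ w) ∷ L} (there v∈L) = there (∈-tailsWith false v∈L)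
  ∈-tailsWith false {L = (true  ∷ w) ∷ L} (there v∈L) = ∈-tailsWith false v∈L
  ∈-tailsWith true  {L = (false ∷ w) ∷ L} (there v∈L) = ∈-tailsWith true v∈L
  ∈-tailsWith true  {L = (true  ∷ w) ∷ L} (there v∈L) = there (∈-tailsWith true v∈L)

  ∃∉ : ∀ n (L : List (Subset n)) → length L < 2 ^ n → ∃ λ v → v ∉ L
  ∃∉ zero    []      _         = [] , λ ()
  ∃∉ zero    (_ ∷ L) (s≤s ())
  ∃∉ (suc n) L       short with length (tailsWith false L) <? 2 ^ n
  ... | yes short₀ = let v , v∉ = ∃∉ n (tailsWith false L) short₀
                     in false ∷ v , λ v∈L → v∉ (∈-tailsWith false v∈L)
  ... | no  long₀  = let v , v∉ = ∃∉ n (tailsWith true L) short₁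
                     in true ∷ v , λ v∈L → v∉ (∈-tailsWith true v∈L)
    where
    short₁ : length (tailsWith true L) < 2 ^ n
    short₁ = +-cancelˡ-< (2 ^ n) _ _ (begin-strict
      2 ^ n + length (tailsWith true L)                       ≤⟨ +-monoˡ-≤ _ (≮⇒≥ long₀) ⟩
      length (tailsWith false L) + length (tailsWith true L)  ≡⟨ length-tailsWith L ⟩
      length L                                                <⟨ short ⟩
      2 ^ suc n                                               ≡⟨ cong (2 ^ n +_) (+-identityʳ (2 ^ n)) ⟩
      2 ^ n + 2 ^ n                                           ∎)
      where open ≤-Reasoning

module GilbertVarshamov where

  open LinearAlgebra using (_⊛_; ⊕-identityˡ; ⊕≡⊥⇒≡; ⊛-units)
  open GaussianElimination using (IndependentOn)
  open HammingBall using (ball; volume; length-ball; ∈-ball; volume-mono; ∃∉)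
  open import Data.Bool using (true; false)
  open import Data.Fin.Subset using (Subset; ⊥; ⁅_⁆; ∣_∣)
  open import Data.Fin.Subset.Properties using (p⊆q⇒∣p∣≤∣q∣)
  open import Data.List using (map; length)
  open import Data.List.Properties using (length-map)
  open import Data.List.Membership.Propositional using (_∈_; _∉_)
  open import Data.List.Membership.Propositional.Properties using (∈-map⁺)
  open import Data.Nat using (ℕ; zero; suc; _+_; _^_; _≤_; _<_; s≤s⁻¹)
  open import Data.Nat.Properties using (≤-trans; ≤-<-trans)
  open import Data.Product using (Σ; _,_)
  open import Data.Vec using (Vec; []; _∷_; _++_; tabulate)
  open import Relation.Nullary using (contradiction)
  open import Relation.Binary.PropositionalEquality using (_≡_; sym; trans; cong; subst)

  private
    variable
      k m : ℕ

  Independent≤ : ℕ → Vec (Subset m) k → Set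
  Independent≤ q G = ∀ u → ∣ u ∣ ≤ q → u ⊛ G ≡ ⊥ → u ≡ ⊥

  Independent≤⇒IndependentOn : ∀ {q J} {G : Vec (Subset m) k} → Independent≤ q G → ∣ J ∣ ≤ q → IndependentOn J G
  Independent≤⇒IndependentOn ind ∣J∣≤q u u⊆J = ind u (≤-trans (p⊆q⇒∣p∣≤∣q∣ u⊆J) ∣J∣≤q)

  units-independent : ∀ q → Independent≤ q (tabulate {n = m} ⁅_⁆)
  units-independent q u _ u⊛I≡⊥ = trans (sym (⊛-units u)) u⊛I≡⊥

  extend-independent : ∀ t (G : Vec (Subset m) k) → Independent≤ (suc t) G →
                       ∀ c → c ∉ map (_⊛ G) (ball k t) → Independent≤ (suc t) (c ∷ G)
  extend-independent t G ind c c∉ (false ∷ u) ∣u∣≤1+t u⊛G≡⊥ =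
    cong (false ∷_) (ind u ∣u∣≤1+t (trans (sym (⊕-identityˡ (u ⊛ G))) u⊛G≡⊥))
  extend-independent t G ind c c∉ (true  ∷ u) ∣u∣≤1+t c⊕u⊛G≡⊥ =
    contradiction (subst (_∈ map (_⊛ G) (ball _ t)) (sym (⊕≡⊥⇒≡ c (u ⊛ G) c⊕u⊛G≡⊥))
                         (∈-map⁺ (_⊛ G) (∈-ball t u (s≤s⁻¹ ∣u∣≤1+t))))
                  c∉

  greedy : ∀ t d → volume (d + m) t < 2 ^ m →
           Σ (Vec (Subset m) d) λ C → Independent≤ (suc t) (C ++ tabulate ⁅_⁆)
  greedy t zero    _     = [] , units-independent (suc t)
  greedy {m} t (suc d) small with greedy t d (≤-<-trans (volume-mono (d + m) t) small)
  ... | C , ind with ∃∉ m (map (_⊛ (C ++ tabulate ⁅_⁆)) (ball (d + m) t)) few-sums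
    where
    few-sums : length (map (_⊛ (C ++ tabulate ⁅_⁆)) (ball (d + m) t)) < 2 ^ m
    few-sums = subst (_< 2 ^ m) (sym (trans (length-map _ (ball (d + m) t)) (length-ball (d + m) t)))
                     (≤-<-trans (volume-mono (d + m) t) small)
  ... | c , c∉ = c ∷ C , extend-independent t (C ++ tabulate ⁅_⁆) ind c c∉

module PairedSets where

  open import Defs using (reflect; _△_; Paired)
  open LinearAlgebra using (_⊕_)
  open Agreement
  open SubsetProperties
  open import Data.Bool using (false; not; _∧_; _∨_)
  open import Data.Bool.Properties using (∨-identityʳ)
  open import Data.Fin.Subset using (Subset; ⊥; ∁; _∪_; _∩_; _─_; _∈_; _∉_; _⊆_; ∣_∣)
  open import Data.Fin.Subset.Properties using (x∈p∩q⁺; ∉⊥; p⊆p∪q; q⊆p∪q; p─q⊆p; ∣p∣≤n; ∣∁p∣≡n∸∣p∣)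
  open import Data.Nat using (ℕ; _+_; _∸_)
  open import Data.Nat.Properties using (m+[n∸m]≡n)
  open import Data.Product using (_×_; _,_; proj₁; proj₂; uncurry)
  open import Data.Product.Function.NonDependent.Propositional using (_×-⇔_)
  open import Data.Vec using (_++_; reverse; lookup)
  open import Data.Vec.Properties
    using (zipWith-++; reverse-involutive; map-++; map-reverse; ++-injectiveˡ; lookup-zipWith; lookup-map; []=⇒lookup)
  open import Function.Bundles using (_⇔_; mk⇔)
  open import Function.Construct.Composition using (_⇔-∘_)
  open import Function.Construct.Identity using (⇔-id)
  open import Function.Properties.Equivalence using (⇔-setoid)
  open import Level using (0ℓ)
  open import Relation.Binary.PropositionalEquality using (_≡_; trans; cong; cong₂; subst; module ≡-Reasoning)

  private
    variable
      n : ℕ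

  paired : Subset n → Subset (n + n)
  paired z = z ++ reverse (∁ z)

  paired-Paired : (z : Subset n) → Paired (paired z)
  paired-Paired z = begin
    reflect (z ++ reverse (∁ z))          ≡⟨ reflect≡reverse (z ++ reverse (∁ z)) ⟩
    reverse (z ++ reverse (∁ z))          ≡⟨ reverse-++ z (reverse (∁ z)) ⟩
    reverse (reverse (∁ z)) ++ reverse z  ≡⟨ cong (_++ reverse z) (reverse-involutive (∁ z)) ⟩
    ∁ z ++ reverse z                      ≡⟨ cong (λ w → ∁ z ++ reverse w) (∁-involutive z) ⟨
    ∁ z ++ reverse (∁ (∁ z))              ≡⟨ cong (∁ z ++_) (map-reverse not (∁ z)) ⟨
    ∁ z ++ ∁ (reverse (∁ z))              ≡⟨ map-++ not z (reverse (∁ z)) ⟨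
    ∁ (z ++ reverse (∁ z))                ∎
    where open ≡-Reasoning

  paired-size : (z : Subset n) → ∣ paired z ∣ ≡ n
  paired-size {n} z = begin
    ∣ z ++ reverse (∁ z) ∣      ≡⟨ ∣++∣ z (reverse (∁ z)) ⟩
    ∣ z ∣ + ∣ reverse (∁ z) ∣   ≡⟨ cong (∣ z ∣ +_) (trans (∣reverse∣ (∁ z)) (∣∁p∣≡n∸∣p∣ z)) ⟩
    ∣ z ∣ + (n ∸ ∣ z ∣)         ≡⟨ m+[n∸m]≡n (∣p∣≤n z) ⟩
    n                           ∎
    where open ≡-Reasoning

  paired-distance : (a b : Subset n) → ∣ paired a △ paired b ∣ ≡ ∣ a ⊕ b ∣ + ∣ a ⊕ b ∣
  paired-distance a b = begin
    ∣ paired a △ paired b ∣                          ≡⟨ cong ∣_∣ (△≡⊕ (paired a) (paired b)) ⟩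
    ∣ paired a ⊕ paired b ∣                          ≡⟨ cong ∣_∣ (zipWith-++ _ a (reverse (∁ a)) b (reverse (∁ b))) ⟩
    ∣ (a ⊕ b) ++ (reverse (∁ a) ⊕ reverse (∁ b)) ∣   ≡⟨ cong (λ w → ∣ (a ⊕ b) ++ w ∣) (zipWith-reverse _ (∁ a) (∁ b)) ⟩
    ∣ (a ⊕ b) ++ reverse (∁ a ⊕ ∁ b) ∣               ≡⟨ cong (λ w → ∣ (a ⊕ b) ++ reverse w ∣) (∁-⊕ a b) ⟩
    ∣ (a ⊕ b) ++ reverse (a ⊕ b) ∣                   ≡⟨ ∣++∣ (a ⊕ b) (reverse (a ⊕ b)) ⟩
    ∣ a ⊕ b ∣ + ∣ reverse (a ⊕ b) ∣                  ≡⟨ cong (∣ a ⊕ b ∣ +_) (∣reverse∣ (a ⊕ b)) ⟩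
    ∣ a ⊕ b ∣ + ∣ a ⊕ b ∣                            ∎
    where open ≡-Reasoning

  paired-injective : {a b : Subset n} → paired a ≡ paired b → a ≡ b
  paired-injective {a = a} {b} = ++-injectiveˡ a b

  halves-disjoint : (J₁ J₂ : Subset n) → (J₁ ++ J₂) ∩ reflect (J₁ ++ J₂) ≡ ⊥ → J₁ ∩ reverse J₂ ≡ ⊥
  halves-disjoint {n} J₁ J₂ J∩J*≡⊥ = ++-injectiveˡ (J₁ ∩ reverse J₂) ⊥ (begin
    (J₁ ∩ reverse J₂) ++ (J₂ ∩ reverse J₁)   ≡⟨ zipWith-++ _ J₁ J₂ (reverse J₂) (reverse J₁) ⟨
    (J₁ ++ J₂) ∩ (reverse J₂ ++ reverse J₁)  ≡⟨ cong ((J₁ ++ J₂) ∩_) (reverse-++ J₁ J₂) ⟨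
    (J₁ ++ J₂) ∩ reverse (J₁ ++ J₂)          ≡⟨ cong ((J₁ ++ J₂) ∩_) (reflect≡reverse (J₁ ++ J₂)) ⟨
    (J₁ ++ J₂) ∩ reflect (J₁ ++ J₂)          ≡⟨ J∩J*≡⊥ ⟩
    ⊥                                        ≡⟨ ⊥-++ n n ⟩
    ⊥ {n} ++ ⊥ {n}                           ∎)
    where open ≡-Reasoning

  module Folding (J₁ J₂ A₁ A₂ : Subset n) (A⊆J : A₁ ++ A₂ ⊆ J₁ ++ J₂) (disjoint : J₁ ∩ reverse J₂ ≡ ⊥) where

    foldedMask : Subset n
    foldedMask = J₁ ∪ reverse J₂

    -- The second half of paired z is reverse (∁ z), so on reverse J₂ the bits of z must be ∁ (reverse A₂).
    foldedTarget : Subset n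
    foldedTarget = A₁ ∪ (reverse J₂ ─ reverse A₂)

    private
      A₁⊆J₁ : A₁ ⊆ J₁
      A₁⊆J₁ = proj₁ (++-⊆⁻ A₁ J₁ A⊆J)
      A₂⊆J₂ : A₂ ⊆ J₂
      A₂⊆J₂ = proj₂ (++-⊆⁻ A₁ J₁ A⊆J)

      separate : ∀ {i} → i ∈ J₁ → i ∉ reverse J₂
      separate i∈J₁ i∈J₂′ = ∉⊥ (subst (_ ∈_) disjoint (x∈p∩q⁺ (i∈J₁ , i∈J₂′)))

    target-on-J₁ : foldedTarget ≈[ J₁ ] A₁
    target-on-J₁ = agree λ {i} i∈J₁ → begin
      lookup (A₁ ∪ (reverse J₂ ─ reverse A₂)) i         ≡⟨ lookup-zipWith _∨_ i A₁ (reverse J₂ ─ reverse A₂) ⟩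
      lookup A₁ i ∨ lookup (reverse J₂ ─ reverse A₂) i  ≡⟨ cong (lookup A₁ i ∨_) (∉⇒lookup≡false λ i∈ →
                                                              separate i∈J₁ (p─q⊆p (reverse J₂) (reverse A₂) i∈)) ⟩
      lookup A₁ i ∨ false                               ≡⟨ ∨-identityʳ (lookup A₁ i) ⟩
      lookup A₁ i                                       ∎
      where open ≡-Reasoning

    target-on-J₂ : foldedTarget ≈[ reverse J₂ ] ∁ (reverse A₂)
    target-on-J₂ = agree λ {i} i∈J₂′ → begin
      lookup (A₁ ∪ (reverse J₂ ─ reverse A₂)) i         ≡⟨ lookup-zipWith _∨_ i A₁ (reverse J₂ ─ reverse A₂) ⟩
      lookup A₁ i ∨ lookup (reverse J₂ ─ reverse A₂) i  ≡⟨ cong₂ _∨_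
                                                              (∉⇒lookup≡false λ i∈A₁ → separate (A₁⊆J₁ i∈A₁) i∈J₂′)
                                                              (lookup-─ (reverse J₂) (reverse A₂) i ([]=⇒lookup i∈J₂′)) ⟩
      not (lookup (reverse A₂) i)                       ≡⟨ lookup-map i not (reverse A₂) ⟨
      lookup (∁ (reverse A₂)) i                         ∎
      where open ≡-Reasoning

    private
      retarget : ∀ {z} → (z ≈[ J₁ ] A₁ × z ≈[ reverse J₂ ] ∁ (reverse A₂)) ⇔
                         (z ≈[ J₁ ] foldedTarget × z ≈[ reverse J₂ ] foldedTarget)
      retarget = mk⇔
        (λ (z≈A₁ , z≈∁A₂) → ≈-trans z≈A₁ (≈-sym target-on-J₁) , ≈-trans z≈∁A₂ (≈-sym target-on-J₂))
        (λ (z≈t₁ , z≈t₂)  → ≈-trans z≈t₁ target-on-J₁ , ≈-trans z≈t₂ target-on-J₂)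

      glue : ∀ {z} → (z ≈[ J₁ ] foldedTarget × z ≈[ reverse J₂ ] foldedTarget) ⇔ (z ≈[ foldedMask ] foldedTarget)
      glue = mk⇔ (uncurry ≈-∪) λ z≈t → ≈-⊆ (p⊆p∪q (reverse J₂)) z≈t , ≈-⊆ (q⊆p∪q J₁ (reverse J₂)) z≈t

    paired-∩≡⇔ : (z : Subset n) → ((J₁ ++ J₂) ∩ paired z ≡ A₁ ++ A₂) ⇔ (z ≈[ foldedMask ] foldedTarget)
    paired-∩≡⇔ z = begin
      (J₁ ++ J₂) ∩ paired z ≡ A₁ ++ A₂
        ≡⟨ cong (_≡ A₁ ++ A₂) (zipWith-++ _∧_ J₁ J₂ z (reverse (∁ z))) ⟩
      (J₁ ∩ z) ++ (J₂ ∩ reverse (∁ z)) ≡ A₁ ++ A₂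
        ≈⟨ ++-≡⇔ (J₁ ∩ z) A₁ ⟩
      (J₁ ∩ z ≡ A₁ × J₂ ∩ reverse (∁ z) ≡ A₂)
        ≈⟨ ∩≡⇔≈ A₁⊆J₁ ×-⇔ ∩≡⇔≈ A₂⊆J₂ ⟩
      (z ≈[ J₁ ] A₁ × reverse (∁ z) ≈[ J₂ ] A₂)
        ≈⟨ ⇔-id _ ×-⇔ (≈-∁⇔ ⇔-∘ ≈-reverse⇔) ⟩
      (z ≈[ J₁ ] A₁ × z ≈[ reverse J₂ ] ∁ (reverse A₂))
        ≈⟨ retarget ⟩
      (z ≈[ J₁ ] foldedTarget × z ≈[ reverse J₂ ] foldedTarget)
        ≈⟨ glue ⟩
      z ≈[ foldedMask ] foldedTarget
        ∎
      where open import Relation.Binary.Reasoning.Setoid (⇔-setoid 0ℓ)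

    foldedMask-size : ∣ foldedMask ∣ ≡ ∣ J₁ ++ J₂ ∣
    foldedMask-size = begin
      ∣ J₁ ∪ reverse J₂ ∣      ≡⟨ ∣∪∣-disjoint J₁ (reverse J₂) disjoint ⟩
      ∣ J₁ ∣ + ∣ reverse J₂ ∣  ≡⟨ cong (∣ J₁ ∣ +_) (∣reverse∣ J₂) ⟩
      ∣ J₁ ∣ + ∣ J₂ ∣          ≡⟨ ∣++∣ J₁ J₂ ⟨
      ∣ J₁ ++ J₂ ∣             ∎
      where open ≡-Reasoning

module CosetFamilies where

  open import Defs using (reflect; Paired; PairedUniform; countWith; _≟ˢ_; _△_)
  open LinearAlgebra
  open Agreement using (_≈[_]?_; ≈-⊕⇔)
  open Counting using (subsets; length-subsets; ∈-subsets; subsets-unique; count-cong; length-filter-subsets)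
  open GaussianElimination using (IndependentOn; #solutions; solutions-count)
  open GilbertVarshamov using (Independent≤; Independent≤⇒IndependentOn)
  open HammingBall using (ball; volume; length-ball; ∈-ball; ∃∉)
  open PairedSets
  open import Data.Fin.Subset using (Subset; ⊥; _∩_; _⊆_; ∣_∣)
  open import Data.List using (List; []; _∷_; map; length; cartesianProductWith)
  open import Data.List.Properties using (length-map; length-++)
  open import Data.List.Membership.Propositional using (_∈_)
  open import Data.List.Membership.Propositional.Properties using (∈-map⁻; ∈-cartesianProductWith⁺)
  open import Data.List.Relation.Unary.Unique.Propositional using (Unique)
  import Data.List.Relation.Unary.Unique.Propositional.Properties as Unique
  open import Data.Nat using (ℕ; suc; _+_; _*_; _^_; _≤_; _<_)
  open import Data.Nat.Properties using (≤-reflexive; +-mono-≤; ≰⇒>)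
  open import Data.Product using (∃; _,_)
  open import Data.Vec using (Vec; splitAt; _++_)
  open import Function.Construct.Composition using (_⇔-∘_)
  open import Relation.Nullary.Decidable using (does-⇔)
  open import Relation.Binary.PropositionalEquality using (_≡_; refl; sym; trans; cong; cong₂; subst)
  open Relation.Binary.PropositionalEquality.≡-Reasoning

  private
    variable
      m n : ℕ

  family : Vec (Subset m) n → Subset n → List (Subset (n + n))
  family G v = map (λ x → paired (encode G x ⊕ v)) (subsets _)

  length-family : (G : Vec (Subset m) n) (v : Subset n) → length (family G v) ≡ 2 ^ m
  length-family {m} G v = trans (length-map _ (subsets m)) (length-subsets m)

  family-unique : (G : Vec (Subset m) n) (v : Subset n) →
                  (∀ {x y} → encode G x ≡ encode G y → x ≡ y) → Unique (family G v)
  family-unique {m} G v encode-injective =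
    Unique.map⁺ (λ eq → encode-injective (⊕-injectiveʳ v (paired-injective eq))) (subsets-unique m)

  family-member : (G : Vec (Subset m) n) (v : Subset n) {I : Subset (n + n)} →
                  I ∈ family G v → ∃ λ x → I ≡ paired (encode G x ⊕ v)
  family-member G v I∈ with ∈-map⁻ _ I∈
  ... | x , _ , I≡ = x , I≡

  family-size : (G : Vec (Subset m) n) (v : Subset n) {I : Subset (n + n)} → I ∈ family G v → ∣ I ∣ ≡ n
  family-size G v I∈ with family-member G v I∈
  ... | x , refl = paired-size (encode G x ⊕ v)

  family-uniform : ∀ {q} (G : Vec (Subset m) n) (v : Subset n) → Independent≤ q G →
                   PairedUniform q (family G v)
  family-uniform {m} {n} {q} G v independent = paired-members , uniform
    where
    paired-members : ∀ {I} → I ∈ family G v → Paired I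
    paired-members I∈ with family-member G v I∈
    ... | x , refl = paired-Paired (encode G x ⊕ v)
    uniform : ∀ J → ∣ J ∣ ≡ q → J ∩ reflect J ≡ ⊥ → ∀ A → A ⊆ J →
              countWith (family G v) J A * 2 ^ q ≡ length (family G v)
    uniform J ∣J∣≡q J∩J*≡⊥ A A⊆J with splitAt n J | splitAt n A
    ... | J₁ , J₂ , refl | A₁ , A₂ , refl = begin
      countWith (family G v) (J₁ ++ J₂) (A₁ ++ A₂) * 2 ^ q
        ≡⟨ cong₂ (λ c e → c * 2 ^ e) folded (trans (sym ∣J∣≡q) (sym foldedMask-size)) ⟩
      #solutions G foldedMask (foldedTarget ⊕ v) * 2 ^ ∣ foldedMask ∣
        ≡⟨ solutions-count m G foldedMask (foldedTarget ⊕ v) independentOn ⟩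
      2 ^ m
        ≡⟨ length-family G v ⟨
      length (family G v)
        ∎
      where
      open Folding J₁ J₂ A₁ A₂ A⊆J (halves-disjoint J₁ J₂ J∩J*≡⊥)
      independentOn : IndependentOn foldedMask G
      independentOn = Independent≤⇒IndependentOn independent (≤-reflexive (trans foldedMask-size ∣J∣≡q))
      folded : countWith (family G v) (J₁ ++ J₂) (A₁ ++ A₂) ≡ #solutions G foldedMask (foldedTarget ⊕ v)
      folded = trans
        (length-filter-subsets (λ I → ((J₁ ++ J₂) ∩ I) ≟ˢ (A₁ ++ A₂)) (λ x → paired (encode G x ⊕ v)))
        (count-cong λ x → does-⇔ (≈-⊕⇔ ⇔-∘ paired-∩≡⇔ (encode G x ⊕ v))
                                 (((J₁ ++ J₂) ∩ paired (encode G x ⊕ v)) ≟ˢ (A₁ ++ A₂))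
                                 (encode G x ≈[ foldedMask ]? foldedTarget ⊕ v))

  family-far : ∀ {t} (G : Vec (Subset m) n) (v : Subset n) → (∀ x → t < ∣ encode G x ⊕ v ∣) →
               ∀ {I₁ I₂} → I₁ ∈ family G ⊥ → I₂ ∈ family G v → suc t + suc t ≤ ∣ I₁ △ I₂ ∣
  family-far {t = t} G v far I₁∈ I₂∈ with family-member G ⊥ I₁∈ | family-member G v I₂∈
  ... | x , refl | y , refl =
    subst (suc t + suc t ≤_) (sym (paired-distance (encode G x ⊕ ⊥) (encode G y ⊕ v)))
          (+-mono-≤ far-xy far-xy)
    where
    translate : (encode G x ⊕ ⊥) ⊕ (encode G y ⊕ v) ≡ encode G (x ⊕ y) ⊕ v
    translate = begin
      (encode G x ⊕ ⊥) ⊕ (encode G y ⊕ v)   ≡⟨ cong (_⊕ (encode G y ⊕ v)) (⊕-identityʳ (encode G x)) ⟩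
      encode G x ⊕ (encode G y ⊕ v)         ≡⟨ ⊕-assoc (encode G x) (encode G y) v ⟨
      (encode G x ⊕ encode G y) ⊕ v         ≡⟨ cong (_⊕ v) (encode-⊕ G x y) ⟨
      encode G (x ⊕ y) ⊕ v                  ∎
    far-xy : t < ∣ (encode G x ⊕ ⊥) ⊕ (encode G y ⊕ v) ∣
    far-xy = subst (λ w → t < ∣ w ∣) (sym translate) (far (x ⊕ y))

  length-cartesianProductWith : {A B C : Set} (f : A → B → C) (xs : List A) (ys : List B) →
                                length (cartesianProductWith f xs ys) ≡ length xs * length ys
  length-cartesianProductWith f []       ys = refl
  length-cartesianProductWith f (x ∷ xs) ys =
    trans (length-++ (map (f x) ys)) (cong₂ _+_ (length-map (f x) ys) (length-cartesianProductWith f xs ys))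

  covering : Vec (Subset m) n → ℕ → List (Subset n)
  covering G t = cartesianProductWith (λ x e → encode G x ⊕ e) (subsets _) (ball _ t)

  length-covering : (G : Vec (Subset m) n) (t : ℕ) → length (covering G t) ≡ 2 ^ m * volume n t
  length-covering {m} {n} G t =
    trans (length-cartesianProductWith _ (subsets m) (ball n t)) (cong₂ _*_ (length-subsets m) (length-ball n t))

  ∃-far-translate : (G : Vec (Subset m) n) (t : ℕ) → 2 ^ m * volume n t < 2 ^ n →
                    ∃ λ v → ∀ x → t < ∣ encode G x ⊕ v ∣
  ∃-far-translate {m} {n} G t few with ∃∉ n (covering G t) (subst (_< 2 ^ n) (sym (length-covering G t)) few)
  ... | v , v∉ = v , λ x → ≰⇒> λ ∣Gx⊕v∣≤t →
    v∉ (subst (_∈ covering G t) (⊕-cancelˡ (encode G x) v)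
              (∈-cartesianProductWith⁺ (λ x e → encode G x ⊕ e) (∈-subsets x) (∈-ball t _ ∣Gx⊕v∣≤t)))

open import Defs
open import Data.Nat using (ℕ; _≤_; _*_; _^_)
open import Data.Product using (Σ; _×_; ∃)
open import Data.Fin.Subset using (Subset; ∣_∣)
open import Data.List using (List; length)
open import Data.List.Membership.Propositional using (_∈_)
open import Data.List.Relation.Unary.Unique.Propositional using (Unique)
open import Relation.Binary.PropositionalEquality using (_≡_)

open LinearAlgebra using (encode; encode-units)
open HammingBall using (volume; volume-small)
open GilbertVarshamov using (greedy)
open CosetFamilies
open import Data.Fin.Subset using (⊥; ⁅_⁆)
open import Data.Nat using (zero; suc; _+_; _<_)
open import Data.Nat.DivMod using (_%_; m/n*n≤m; m%n<n; m≡m%n+[m/n]*n)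
open import Data.Nat.Properties
  using (+-comm; +-suc; +-monoˡ-<; +-monoˡ-≤; +-cancelʳ-≤; *-monoʳ-≤; *-monoˡ-<; *-monoʳ-<;
         ^-distribˡ-+-*; m^n≢0; m≤m+n; ≤-trans; <⇒≱; <ᵇ⇒<; module ≤-Reasoning)
open import Data.Nat.Tactic.RingSolver using (solve-∀)
open import Data.Product using (_,_)
open import Data.Unit using (tt)
open import Data.Vec using (Vec; _++_; tabulate)
open import Data.Vec.Properties using (++-injectiveʳ)
open import Relation.Nullary using (contradiction)
open import Relation.Binary.PropositionalEquality using (refl; sym; trans; subst; subst₂)

ceil5-spec : ∀ n → 1 ≤ n → ∃ λ t → ceil5 n ≡ suc t × 5 * t < n × n ≤ 5 * suc t
ceil5-spec n 1≤n = split (ceil5 n) refl (m/n*n≤m (n + 4) 5) above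
  where
  open ≤-Reasoning
  above : n + 4 < ceil5 n * 5 + 5
  above = begin-strict
    n + 4                       ≡⟨ m≡m%n+[m/n]*n (n + 4) 5 ⟩
    (n + 4) % 5 + ceil5 n * 5   <⟨ +-monoˡ-< (ceil5 n * 5) (m%n<n (n + 4) 5) ⟩
    5 + ceil5 n * 5             ≡⟨ +-comm 5 (ceil5 n * 5) ⟩
    ceil5 n * 5 + 5             ∎
  split : ∀ q → ceil5 n ≡ q → q * 5 ≤ n + 4 → n + 4 < q * 5 + 5 →
          ∃ λ t → ceil5 n ≡ suc t × 5 * t < n × n ≤ 5 * suc t
  split zero    _    _     n+4<5  = contradiction (+-monoˡ-≤ 4 1≤n) (<⇒≱ n+4<5)
  split (suc t) q≡1+t below above′ = t , q≡1+t , lower , upper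
    where
    lower : 5 * t < n
    lower = +-cancelʳ-≤ 4 (suc (5 * t)) n (subst (_≤ n + 4) (shift t) below)
      where
      shift : ∀ t → suc t * 5 ≡ suc (5 * t) + 4
      shift = solve-∀
    upper : n ≤ 5 * suc t
    upper = +-cancelʳ-≤ 5 n (5 * suc t)
              (subst (n + 5 ≤_) (swap t) (subst (_≤ suc t * 5 + 5) (sym (+-suc n 4)) above′))
      where
      swap : ∀ t → suc t * 5 + 5 ≡ 5 * suc t + 5
      swap = solve-∀

far-enough : ∀ m t d → m ≤ 5 * suc t → suc t + suc t ≤ d → 1 * ((m + m) + (m + m)) < 30 * d
far-enough m t d m≤5q 2q≤d = begin-strict
  1 * ((m + m) + (m + m))  ≡⟨ four m ⟩
  4 * m                    ≤⟨ *-monoʳ-≤ 4 m≤5q ⟩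
  4 * (5 * suc t)          ≡⟨ twenty (suc t) ⟩
  20 * suc t               <⟨ *-monoˡ-< (suc t) (<ᵇ⇒< 20 60 tt) ⟩
  60 * suc t               ≡⟨ sixty (suc t) ⟩
  30 * (suc t + suc t)     ≤⟨ *-monoʳ-≤ 30 2q≤d ⟩
  30 * d                   ∎
  where
  open ≤-Reasoning
  four : ∀ m → 1 * ((m + m) + (m + m)) ≡ 4 * m
  four = solve-∀
  twenty : ∀ q → 4 * (5 * q) ≡ 20 * q
  twenty = solve-∀
  sixty : ∀ q → 60 * q ≡ 30 * (q + q)
  sixty = solve-∀

FarUniformFamilies : (k q s N : ℕ) → Set
FarUniformFamilies k q s N =
  Σ (List (Subset k)) λ 𝓘₁ → Σ (List (Subset k)) λ 𝓘₂ →
    Unique 𝓘₁ × Unique 𝓘₂ × length 𝓘₁ ≡ N × length 𝓘₂ ≡ N ×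
    PairedUniform q 𝓘₁ × PairedUniform q 𝓘₂ × PairwiseFar 1 30 𝓘₁ 𝓘₂ ×
    (∀ {I} → I ∈ 𝓘₁ → ∣ I ∣ ≡ s) × (∀ {I} → I ∈ 𝓘₂ → ∣ I ∣ ≡ s)

families : ∀ m → 1 ≤ m → FarUniformFamilies ((m + m) + (m + m)) (ceil5 m) (m + m) (2 ^ m)
families m 1≤m with ceil5-spec m 1≤m
... | t , q≡1+t , 5t<m , m≤5q with greedy t m (volume-small m t 1≤m 5t<m)
... | C , independent with ∃-far-translate (C ++ tabulate ⁅_⁆) t translates-fit
  where
  translates-fit : 2 ^ m * volume (m + m) t < 2 ^ (m + m)
  translates-fit = subst (2 ^ m * volume (m + m) t <_) (sym (^-distribˡ-+-* 2 m m))
                         (*-monoʳ-< (2 ^ m) {{m^n≢0 2 m}} (volume-small m t 1≤m 5t<m))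
... | v , far =
  family G ⊥ , family G v , family-unique G ⊥ injective , family-unique G v injective ,
  length-family G ⊥ , length-family G v , uniform ⊥ , uniform v ,
  (λ I₁∈ I₂∈ → far-enough m t _ m≤5q (family-far G v far I₁∈ I₂∈)) ,
  family-size G ⊥ , family-size G v
  where
  G : Vec (Subset m) (m + m)
  G = C ++ tabulate ⁅_⁆
  injective : ∀ {x y} → encode G x ≡ encode G y → x ≡ y
  injective {x} {y} eq =
    ++-injectiveʳ (encode C x) (encode C y) (trans (sym (encode-units C x)) (trans eq (encode-units C y)))
  uniform : ∀ w → PairedUniform (ceil5 m) (family G w)
  uniform w = subst (λ q → PairedUniform q (family G w)) (sym q≡1+t) (family-uniform G w independent)

lemma10p40 : Σ ℕ λ R → ∀ (r : ℕ) → R ≤ r →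
    Σ (List (Subset (8 * r))) λ 𝓘₁ → Σ (List (Subset (8 * r))) λ 𝓘₂ →
      Unique 𝓘₁ × Unique 𝓘₂ ×
      length 𝓘₁ ≡ 2 ^ (2 * r) × length 𝓘₂ ≡ 2 ^ (2 * r) ×
      PairedUniform (ceil5 (2 * r)) 𝓘₁ × PairedUniform (ceil5 (2 * r)) 𝓘₂ ×
      PairwiseFar 1 30 𝓘₁ 𝓘₂ ×
      (∀ {I} → I ∈ 𝓘₁ → ∣ I ∣ ≡ 4 * r) × (∀ {I} → I ∈ 𝓘₂ → ∣ I ∣ ≡ 4 * r)
lemma10p40 = 1 , λ r 1≤r →
  subst₂ (λ k s → FarUniformFamilies k (ceil5 (2 * r)) s (2 ^ (2 * r))) (eight r) (four r)
         (families (2 * r) (≤-trans 1≤r (m≤m+n r (r + 0))))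
  where
  eight : ∀ r → (2 * r + 2 * r) + (2 * r + 2 * r) ≡ 8 * r
  eight = solve-∀
  four : ∀ r → 2 * r + 2 * r ≡ 4 * r
  four = solve-∀
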